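{- Let $\mathcal{P}$ be a collection of permutations such that $\mathcal{P}_n=\mathcal{P}\cap\mathcal{S}_n$ is non-empty for infinitely many $n$. Suppose each $\mathcal{P}_n$ is a union of conjugacy classes of $\mathcal{S}_n$, and that the average number of fixed points of elements of $\mathcal{P}_n$ is $o(n)$ as $n\to\infty$ (over $n$ with $\mathcal{P}_n\neq\emptyset$). Then $\mathcal{P}$ is quasirandom.
   Context: $\mathcal{S}_n$ is the set of all permutations of $[n]=\{1,\dots,n\}$. For a sequence $\tau$ of $k$ distinct elements of $[n]$, a permutation $\pi\in\mathcal{S}_n$ has $\tau$ as a subsequence if $\tau$ is a subsequence of the one-line notation $\pi(1)\pi(2)\cdots\pi(n)$. Let $h(n,\tau)$ be the number of elements of $\mathcal{P}_n$ having $\tau$ as a subsequence, and for $\mathcal{P}_n\ne\emptyset$ let $\tilde p(n,\tau)=h(n,\tau)/|\mathcal{P}_n|$. The collection $\mathcal{P}$ is called quasirandom if for each $k\ge1$, \[\lim_{n\to\infty}\max_\tau\left|\tilde p(n,\tau)-\frac{1}{k!}\right|=0,\] where the limit is taken over those $n$ for which $\mathcal{P}_n$ is nonempty and the maximum is over all sequences $\tau$ of $k$ distinct elements of $[n]$. -}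

module Defs where

open import Data.Bool using (Bool; true; false)
open import Data.Nat using (ℕ; zero; suc; _!)
open import Data.Fin using (Fin)
open import Data.Fin.Properties using (_≟_)
open import Data.Vec using (Vec; []; _∷_; lookup; toList)
open import Data.List using (List; []; _∷_; map; concatMap; length; filterᵇ; allFin)
open import Data.Nat.ListAction using (sum)
open import Data.List.Relation.Unary.Unique.Propositional using (Unique)
import Data.List.Relation.Unary.Unique.DecPropositional as UniqueDec
import Data.List.Relation.Binary.Sublist.DecPropositional as SublistDec
open import Data.Integer using (+_)
open import Data.Rational using (ℚ; 0ℚ; _/_)
open import Relation.Nullary using (does)

-- A permutation of [n] in one-line notation π(1)…π(n): a vector of length n
-- (entries in Fin n) with pairwise distinct entries.

allVecs : (n k : ℕ) → List (Vec (Fin n) k)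
allVecs n zero    = [] ∷ []
allVecs n (suc k) = concatMap (λ x → map (x ∷_) (allVecs n k)) (allFin n)

isPerm : {n : ℕ} → Vec (Fin n) n → Bool
isPerm {n} π = does (UniqueDec.unique? (_≟_ {n}) (toList π))

Sym : (n : ℕ) → List (Vec (Fin n) n)
Sym n = filterᵇ isPerm (allVecs n n)

-- A collection of permutations P, given by its slices P_n ⊆ S_n
-- (P n π ≡ true means π ∈ P_n; values outside S_n are irrelevant).
Collection : Set
Collection = (n : ℕ) → Vec (Fin n) n → Bool

Slice : Collection → (n : ℕ) → List (Vec (Fin n) n)
Slice P n = filterᵇ (P n) (Sym n)

card : Collection → ℕ → ℕ
card P n = length (Slice P n)

hasSubseq : {n k : ℕ} → Vec (Fin n) k → Vec (Fin n) n → Bool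
hasSubseq {n} τ π = does (SublistDec._⊆?_ (_≟_ {n}) (toList τ) (toList π))

h : Collection → (n : ℕ) → {k : ℕ} → Vec (Fin n) k → ℕ
h P n τ = length (filterᵇ (hasSubseq τ) (Slice P n))

fix : {n : ℕ} → Vec (Fin n) n → ℕ
fix {n} π = length (filterᵇ (λ i → does (lookup π i ≟ i)) (allFin n))

totalFix : Collection → ℕ → ℕ
totalFix P n = sum (map fix (Slice P n))

-- a / b as a rational (only used with b ≠ 0)
ratio : ℕ → ℕ → ℚ
ratio a zero    = 0ℚ
ratio a (suc b) = (+ a) / suc b

ptilde : Collection → (n : ℕ) → {k : ℕ} → Vec (Fin n) k → ℚ
ptilde P n τ = ratio (h P n τ) (card P n)

avgFix : Collection → ℕ → ℚ
avgFix P n = ratio (totalFix P n) (card P n)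

invFact : ℕ → ℚ
invFact k = ratio 1 (k !)

-- Fix τ with k distinct entries. Since P_n is closed under conjugation, n! h(n,τ) is the number of pairs
-- (π, σ) ∈ P_n × S_n for which τ is a subsequence of ρ = σπσ⁻¹, that is, for which ρ⁻¹ is increasing on the
-- entries of τ. With b = σ⁻¹τ we have ρ⁻¹τ = σ(π⁻¹b). Unless b meets π⁻¹b (a collision), prescribing σ on b
-- leaves the relative order of σ on π⁻¹b uniform, so exactly a 1/k! fraction of the collision-free σ are hits.
-- A collision forces σπ⁻¹σ⁻¹ to map an entry x of τ to an entry y, which for given x, y happens for at most
-- a fraction fix(π)/n + 1/(n−1) of all σ; hence |p̃(n,τ) − 1/k!| ≤ k² (avgFix/n + 1/(n−1)) → 0.

module Submission where

open import Defs

module Counting where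

  open import Data.Bool.Base using (T; if_then_else_)
  open import Data.Empty using (⊥-elim)
  open import Data.List.Base using (List; []; _∷_; length; map; filter)
  open import Data.List.Membership.Propositional using (_∈_)
  open import Data.List.Membership.Propositional.Properties using (∈-map⁺; ∈-map⁻; ∈-filter⁺; ∈-filter⁻)
  open import Data.List.Membership.Propositional.Properties.WithK using (unique∧set⇒bag)
  open import Data.List.Properties using (length-map)
  open import Data.List.Relation.Binary.BagAndSetEquality using (∼bag⇒↭)
  open import Data.List.Relation.Binary.Permutation.Propositional.Properties using (↭-length)
  open import Data.List.Relation.Unary.All using ([])
  open import Data.List.Relation.Unary.Any using (here; there; any?)
  open import Data.List.Relation.Unary.Unique.Propositional using (Unique; []; _∷_)
  import Data.List.Relation.Unary.Unique.Propositional.Properties as Unique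
  open import Data.Nat.Base using (ℕ; suc; _+_; _*_; _≤_; z≤n; s≤s)
  open import Data.Nat.ListAction using (sum)
  open import Data.Nat.Properties
  open import Algebra.Properties.CommutativeSemigroup +-commutativeSemigroup using (interchange)
  open import Data.Product using (_,_; proj₂)
  open import Data.Unit using (tt)
  open import Function.Base using (_∘_)
  open import Function.Bundles using (_⇔_; mk⇔)
  open import Function.Definitions using (Injective)
  open import Level using (0ℓ)
  open import Relation.Binary.Definitions using (DecidableEquality)
  open import Relation.Binary.PropositionalEquality
  open import Relation.Nullary using (Dec; does; yes; no; ¬_; _×-dec_)
  open import Relation.Unary using (Pred; Decidable)
  open import Relation.Unary.Properties using (∁?; _∩?_)

  count : {A : Set} {P : Pred A 0ℓ} → Decidable P → List A → ℕ
  count P? xs = length (filter P? xs)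

  ∑ : {A : Set} → List A → (A → ℕ) → ℕ
  ∑ xs f = sum (map f xs)

  infix 5 ∑
  syntax ∑ xs (λ x → e) = ∑[ x ∈ xs ] e

  T-does⇔ : {P : Set} (P? : Dec P) → T (does P?) ⇔ P
  T-does⇔ (yes p) = mk⇔ (λ _ → p) (λ _ → tt)
  T-does⇔ (no ¬p) = mk⇔ (λ ()) ¬p

  𝟙 : {P : Set} → Dec P → ℕ
  𝟙 P? = if does P? then 1 else 0

  module _ {A : Set} {P Q : Pred A 0ℓ} (P? : Decidable P) (Q? : Decidable Q) where

    count-cong : (xs : List A) → (∀ {x} → x ∈ xs → P x → Q x) → (∀ {x} → x ∈ xs → Q x → P x) →
                 count P? xs ≡ count Q? xs
    count-cong [] _ _ = refl
    count-cong (x ∷ xs) P⇒Q Q⇒P with P? x | Q? x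
    ... | yes _  | yes _  = cong suc (count-cong xs (P⇒Q ∘ there) (Q⇒P ∘ there))
    ... | no  _  | no  _  = count-cong xs (P⇒Q ∘ there) (Q⇒P ∘ there)
    ... | yes px | no ¬qx = ⊥-elim (¬qx (P⇒Q (here refl) px))
    ... | no ¬px | yes qx = ⊥-elim (¬px (Q⇒P (here refl) qx))

    count-mono : (xs : List A) → (∀ {x} → x ∈ xs → P x → Q x) → count P? xs ≤ count Q? xs
    count-mono [] _ = z≤n
    count-mono (x ∷ xs) P⇒Q with P? x | Q? x
    ... | yes _  | yes _  = s≤s (count-mono xs (P⇒Q ∘ there))
    ... | no  _  | yes _  = m≤n⇒m≤1+n (count-mono xs (P⇒Q ∘ there))
    ... | no  _  | no  _  = count-mono xs (P⇒Q ∘ there)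
    ... | yes px | no ¬qx = ⊥-elim (¬qx (P⇒Q (here refl) px))

    count-split : (xs : List A) → count P? xs ≡ count (P? ∩? Q?) xs + count (P? ∩? ∁? Q?) xs
    count-split [] = refl
    count-split (x ∷ xs) with P? x | Q? x
    ... | yes _ | yes _ = cong suc (count-split xs)
    ... | yes _ | no  _ = trans (cong suc (count-split xs)) (sym (+-suc _ _))
    ... | no  _ | _     = count-split xs

  module _ {A : Set} {P : Pred A 0ℓ} (P? : Decidable P) where

    count-none : (xs : List A) → (∀ {x} → x ∈ xs → ¬ P x) → count P? xs ≡ 0
    count-none [] _ = refl
    count-none (x ∷ xs) ¬P with P? x
    ... | yes px = ⊥-elim (¬P (here refl) px)
    ... | no  _  = count-none xs (¬P ∘ there)

    count+count-∁ : (xs : List A) → count P? xs + count (∁? P?) xs ≡ length xs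
    count+count-∁ [] = refl
    count+count-∁ (x ∷ xs) with P? x
    ... | yes _ = cong suc (count+count-∁ xs)
    ... | no  _ = trans (+-suc _ _) (cong suc (count+count-∁ xs))

    count≡∑𝟙 : (xs : List A) → count P? xs ≡ ∑[ x ∈ xs ] 𝟙 (P? x)
    count≡∑𝟙 [] = refl
    count≡∑𝟙 (x ∷ xs) with P? x
    ... | yes _ = cong suc (count≡∑𝟙 xs)
    ... | no  _ = count≡∑𝟙 xs

    ∑-indicator : (xs : List A) (f : A → ℕ) (c : ℕ) →
                  (∀ {x} → x ∈ xs → P x → f x ≡ c) → (∀ {x} → x ∈ xs → ¬ P x → f x ≡ 0) →
                  ∑ xs f ≡ count P? xs * c
    ∑-indicator [] f c _ _ = refl
    ∑-indicator (x ∷ xs) f c on off with P? x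
    ... | yes px = cong₂ _+_ (on (here refl) px) (∑-indicator xs f c (on ∘ there) (off ∘ there))
    ... | no ¬px = cong₂ _+_ (off (here refl) ¬px) (∑-indicator xs f c (on ∘ there) (off ∘ there))

  module _ {A : Set} where

    ∑-cong : (xs : List A) {f g : A → ℕ} → (∀ {x} → x ∈ xs → f x ≡ g x) → ∑ xs f ≡ ∑ xs g
    ∑-cong [] _ = refl
    ∑-cong (x ∷ xs) f≡g = cong₂ _+_ (f≡g (here refl)) (∑-cong xs (f≡g ∘ there))

    ∑-mono : (xs : List A) {f g : A → ℕ} → (∀ {x} → x ∈ xs → f x ≤ g x) → ∑ xs f ≤ ∑ xs g
    ∑-mono [] _ = z≤n
    ∑-mono (x ∷ xs) f≤g = +-mono-≤ (f≤g (here refl)) (∑-mono xs (f≤g ∘ there))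

    ∑-+ : (xs : List A) (f g : A → ℕ) → ∑[ x ∈ xs ] (f x + g x) ≡ ∑ xs f + ∑ xs g
    ∑-+ [] f g = refl
    ∑-+ (x ∷ xs) f g = trans (cong (f x + g x +_) (∑-+ xs f g)) (interchange (f x) (g x) _ _)

    ∑-*ˡ : (xs : List A) (c : ℕ) (f : A → ℕ) → ∑[ x ∈ xs ] (c * f x) ≡ c * ∑ xs f
    ∑-*ˡ [] c f = sym (*-zeroʳ c)
    ∑-*ˡ (x ∷ xs) c f = trans (cong (c * f x +_) (∑-*ˡ xs c f)) (sym (*-distribˡ-+ c (f x) _))

    ∑-*ʳ : (xs : List A) (f : A → ℕ) (c : ℕ) → ∑[ x ∈ xs ] (f x * c) ≡ ∑ xs f * c
    ∑-*ʳ [] f c = refl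
    ∑-*ʳ (x ∷ xs) f c = trans (cong (f x * c +_) (∑-*ʳ xs f c)) (sym (*-distribʳ-+ c (f x) _))

    ∑-const : (xs : List A) (c : ℕ) → ∑[ x ∈ xs ] c ≡ length xs * c
    ∑-const [] c = refl
    ∑-const (x ∷ xs) c = cong (c +_) (∑-const xs c)

  ∑-comm : {A B : Set} (xs : List A) (ys : List B) (f : A → B → ℕ) →
           ∑[ x ∈ xs ] ∑[ y ∈ ys ] f x y ≡ ∑[ y ∈ ys ] ∑[ x ∈ xs ] f x y
  ∑-comm [] ys f = sym (trans (∑-const ys 0) (*-zeroʳ (length ys)))
  ∑-comm (x ∷ xs) ys f =
    trans (cong (∑ ys (f x) +_) (∑-comm xs ys f)) (sym (∑-+ ys (f x) (λ y → ∑[ x′ ∈ xs ] f x′ y)))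

  module _ {A T : Set} {Q : T → Pred A 0ℓ} (Q? : ∀ t → Decidable (Q t)) where

    count-any≤∑ : (ts : List T) (xs : List A) →
                  count (λ x → any? (λ t → Q? t x) ts) xs ≤ ∑[ t ∈ ts ] count (Q? t) xs
    count-any≤∑ ts xs = begin
      count (λ x → any? (λ t → Q? t x) ts) xs    ≡⟨ count≡∑𝟙 _ xs ⟩
      ∑[ x ∈ xs ] 𝟙 (any? (λ t → Q? t x) ts)     ≤⟨ ∑-mono xs (λ {x} _ → 𝟙-any≤∑ ts x) ⟩
      ∑[ x ∈ xs ] ∑[ t ∈ ts ] 𝟙 (Q? t x)         ≡⟨ ∑-comm xs ts _ ⟩
      ∑[ t ∈ ts ] ∑[ x ∈ xs ] 𝟙 (Q? t x)         ≡⟨ ∑-cong ts (λ {t} _ → count≡∑𝟙 (Q? t) xs) ⟨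
      ∑[ t ∈ ts ] count (Q? t) xs                ∎
      where
      open ≤-Reasoning
      𝟙-any≤∑ : (us : List T) (x : A) → 𝟙 (any? (λ t → Q? t x) us) ≤ ∑[ t ∈ us ] 𝟙 (Q? t x)
      𝟙-any≤∑ [] x = z≤n
      𝟙-any≤∑ (u ∷ us) x with Q? u x
      ... | yes _ = s≤s z≤n
      ... | no  _ = 𝟙-any≤∑ us x

  unique∧set⇒length≡ : {A : Set} {xs ys : List A} → Unique xs → Unique ys → (∀ {x} → x ∈ xs ⇔ x ∈ ys) →
                       length xs ≡ length ys
  unique∧set⇒length≡ xs! ys! xs≈ys = ↭-length (∼bag⇒↭ (unique∧set⇒bag xs! ys! xs≈ys))

  module _ {A B : Set} (_≟_ : DecidableEquality B) where

    count-≟≡1 : {zs : List B} {w : B} → Unique zs → w ∈ zs → count (w ≟_) zs ≡ 1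
    count-≟≡1 {zs} {w} zs! w∈zs = unique∧set⇒length≡ (Unique.filter⁺ (w ≟_) {zs} zs!) ([] ∷ [])
      (mk⇔ (λ x∈ → here (sym (proj₂ (∈-filter⁻ (w ≟_) {xs = zs} x∈))))
           (λ { (here refl) → ∈-filter⁺ (w ≟_) w∈zs refl }))

    count-fibres : {P : Pred A 0ℓ} (P? : Decidable P) (f : A → B) (xs : List A) {zs : List B} → Unique zs →
                   (∀ {x} → x ∈ xs → P x → f x ∈ zs) →
                   count P? xs ≡ ∑[ z ∈ zs ] count (P? ∩? (λ x → f x ≟ z)) xs
    count-fibres P? f xs {zs} zs! f∈zs = begin
      count P? xs                                      ≡⟨ count≡∑𝟙 P? xs ⟩
      ∑[ x ∈ xs ] 𝟙 (P? x)                              ≡⟨ ∑-cong xs 𝟙-fibres ⟩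
      ∑[ x ∈ xs ] ∑[ z ∈ zs ] 𝟙 (P? x ×-dec (f x ≟ z))  ≡⟨ ∑-comm xs zs _ ⟩
      ∑[ z ∈ zs ] ∑[ x ∈ xs ] 𝟙 (P? x ×-dec (f x ≟ z))  ≡⟨ ∑-cong zs (λ _ → count≡∑𝟙 _ xs) ⟨
      ∑[ z ∈ zs ] count (P? ∩? (λ x → f x ≟ z)) xs      ∎
      where
      open ≡-Reasoning
      𝟙-fibres : ∀ {x} → x ∈ xs → 𝟙 (P? x) ≡ ∑[ z ∈ zs ] 𝟙 (P? x ×-dec (f x ≟ z))
      𝟙-fibres {x} x∈xs with P? x
      ... | yes px = sym (trans (sym (count≡∑𝟙 (f x ≟_) zs)) (count-≟≡1 zs! (f∈zs x∈xs px)))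
      ... | no  _  = sym (trans (∑-const zs 0) (*-zeroʳ (length zs)))

  module _ {A B : Set} where

    count-bijection : {P : Pred B 0ℓ} (P? : Decidable P) {xs : List A} {ys : List B} (f : A → B) (g : B → A) →
                      Unique xs → Unique ys → Injective _≡_ _≡_ f →
                      (∀ {x} → x ∈ xs → f x ∈ ys) → (∀ {y} → y ∈ ys → g y ∈ xs) →
                      (∀ {y} → y ∈ ys → f (g y) ≡ y) → count (P? ∘ f) xs ≡ count P? ys
    count-bijection {P} P? {xs} {ys} f g xs! ys! f-inj f∈ g∈ fg = begin
      count (P? ∘ f) xs
        ≡⟨ length-map f (filter (P? ∘ f) xs) ⟨
      length (map f (filter (P? ∘ f) xs))
        ≡⟨ unique∧set⇒length≡ (Unique.map⁺ f-inj (Unique.filter⁺ (P? ∘ f) {xs} xs!)) (Unique.filter⁺ P? {ys} ys!)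
                              (mk⇔ to from) ⟩
      count P? ys ∎
      where
      open ≡-Reasoning
      to : ∀ {y} → y ∈ map f (filter (P? ∘ f) xs) → y ∈ filter P? ys
      to y∈ with x , x∈ , refl ← ∈-map⁻ f y∈ =
        let x∈xs , pfx = ∈-filter⁻ (P? ∘ f) x∈ in ∈-filter⁺ P? (f∈ x∈xs) pfx
      from : ∀ {y} → y ∈ filter P? ys → y ∈ map f (filter (P? ∘ f) xs)
      from {y} y∈ = let y∈ys , py = ∈-filter⁻ P? y∈ in
        subst (_∈ map f _) (fg y∈ys) (∈-map⁺ f (∈-filter⁺ (P? ∘ f) (g∈ y∈ys) (subst P (sym (fg y∈ys)) py)))

module SortedSublists where

  open import Data.Empty using (⊥-elim)
  open import Data.Fin.Base using (Fin) renaming (_<_ to _<ᶠ_)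
  import Data.Fin.Properties as Fin
  open import Data.List.Base using (List; []; _∷_; length; map; _++_; allFin)
  open import Data.List.Membership.Propositional using (_∈_)
  open import Data.List.Membership.Propositional.Properties using (∈-map⁺; ∈-map⁻; ∈-++⁺ˡ; ∈-++⁺ʳ; ∈-++⁻; ∈-allFin)
  open import Data.List.Properties using (length-++; length-map; ∷-injectiveʳ)
  open import Data.List.Relation.Binary.Sublist.Propositional using (_⊆_; []; _∷_; _∷ʳ_; minimum)
  open import Data.List.Relation.Binary.Sublist.Propositional.Properties using (All-resp-⊆; Any-resp-⊆)
  open import Data.List.Relation.Unary.All as All using (All; []; _∷_)
  open import Data.List.Relation.Unary.AllPairs using (AllPairs; []; _∷_)
  import Data.List.Relation.Unary.AllPairs.Properties as AllPairs
  open import Data.List.Relation.Unary.Any using (here; there)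
  open import Data.List.Relation.Unary.Unique.Propositional using (Unique)
  import Data.List.Relation.Unary.Unique.Propositional.Properties as Unique
  open import Data.Nat.Base using (ℕ; zero; suc; _+_; _*_; _∸_; _!; _≤_; _<_; s≤s; NonZero; >-nonZero)
  open import Data.Nat.Combinatorics.Base using (_P′_)
  open import Data.Nat.Combinatorics.Specification using (nP′k≡n[n∸1P′k∸1])
  open import Data.Nat.Properties
  open import Algebra.Properties.CommutativeSemigroup *-commutativeSemigroup using (x∙yz≈y∙xz)
  open import Data.Product using (_×_; _,_; proj₁)
  open import Data.Sum using (inj₁; inj₂)
  open import Function.Base using (id)
  open import Function.Bundles using (_⇔_; mk⇔; module Equivalence)
  open import Level using (0ℓ)
  open import Relation.Binary.Core using (Rel)
  open import Relation.Binary.Definitions using (Irreflexive; Transitive)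
  open import Relation.Binary.PropositionalEquality
  open import Relation.Nullary using (yes; no; ¬_)
  open Equivalence using (to; from)

  module _ {A : Set} {R : Rel A 0ℓ} where

    AllPairs-resp-⊆ : {xs ys : List A} → xs ⊆ ys → AllPairs R ys → AllPairs R xs
    AllPairs-resp-⊆ [] [] = []
    AllPairs-resp-⊆ (_ ∷ʳ xs⊆ys) (_ ∷ ys!) = AllPairs-resp-⊆ xs⊆ys ys!
    AllPairs-resp-⊆ (refl ∷ xs⊆ys) (y<ys ∷ ys!) = All-resp-⊆ xs⊆ys y<ys ∷ AllPairs-resp-⊆ xs⊆ys ys!

  module _ {A : Set} {_<_ : Rel A 0ℓ} (<-irrefl : Irreflexive _≡_ _<_) (<-trans : Transitive _<_) where

    ⊆-sorted⇔ : {xs ys : List A} → AllPairs _<_ ys → xs ⊆ ys ⇔ (AllPairs _<_ xs × All (_∈ ys) xs)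
    ⊆-sorted⇔ ys! = mk⇔ (λ xs⊆ys → AllPairs-resp-⊆ xs⊆ys ys! , All.tabulate (Any-resp-⊆ xs⊆ys))
                        (λ (xs! , xs∈ys) → sorted-⊆ ys! xs! xs∈ys)
      where
      sorted-⊆ : {xs ys : List A} → AllPairs _<_ ys → AllPairs _<_ xs → All (_∈ ys) xs → xs ⊆ ys
      sorted-⊆ {[]} _ _ _ = minimum _
      sorted-⊆ {x ∷ xs} {y ∷ ys} (y<ys ∷ ys!) (x<xs ∷ xs!) (here refl ∷ xs∈) =
        refl ∷ sorted-⊆ ys! xs! (All.zipWith (λ (x<z , z∈) → skip-head x<z z∈) (x<xs , xs∈))
        where
        skip-head : ∀ {z} → x < z → z ∈ x ∷ ys → z ∈ ys
        skip-head x<z (here refl) = ⊥-elim (<-irrefl refl x<z)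
        skip-head x<z (there z∈ys) = z∈ys
      sorted-⊆ {x ∷ xs} {y ∷ ys} (y<ys ∷ ys!) x∷xs!@(x<xs ∷ _) (there x∈ys ∷ xs∈) =
        y ∷ʳ sorted-⊆ ys! x∷xs! (x∈ys ∷ All.zipWith (λ (x<z , z∈) → skip-head x<z z∈) (x<xs , xs∈))
        where
        y<x : y < x
        y<x = All.lookup y<ys x∈ys
        skip-head : ∀ {z} → x < z → z ∈ y ∷ ys → z ∈ ys
        skip-head x<z (here refl) = ⊥-elim (<-irrefl refl (<-trans y<x x<z))
        skip-head x<z (there z∈ys) = z∈ys

  module _ {n : ℕ} where

    Increasing : List (Fin n) → Set
    Increasing = AllPairs _<ᶠ_

    ⊆-allFin⇔Increasing : {ds : List (Fin n)} → ds ⊆ allFin n ⇔ Increasing ds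
    ⊆-allFin⇔Increasing = mk⇔
      (λ ds⊆ → proj₁ (to (⊆-sorted⇔ Fin.<-irrefl Fin.<-trans allFin-increasing) ds⊆))
      (λ ds! → from (⊆-sorted⇔ Fin.<-irrefl Fin.<-trans allFin-increasing) (ds! , All.universal ∈-allFin _))
      where
      allFin-increasing : Increasing (allFin n)
      allFin-increasing = AllPairs.tabulate⁺-< id

  P′-zero : {m k : ℕ} → m < k → m P′ k ≡ 0
  P′-zero {m} {suc k} (s≤s m≤k) with m≤n⇒m<n∨m≡n m≤k
  ... | inj₁ m<k  = trans (cong ((m ∸ k) *_) (P′-zero m<k)) (*-zeroʳ (m ∸ k))
  ... | inj₂ refl = cong (_* (m P′ m)) (n∸n≡0 m)

  P′-nonZero : {n k : ℕ} → k ≤ n → NonZero (n P′ k)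
  P′-nonZero {n} {zero} _ = _
  P′-nonZero {n} {suc k} k<n = m*n≢0 (n ∸ k) (n P′ k) {{>-nonZero (m<n⇒0<n∸m k<n)}} {{P′-nonZero (<⇒≤ k<n)}}

  P′-pascal : (m k : ℕ) → suc m P′ suc k ≡ suc k * (m P′ k) + (m P′ suc k)
  P′-pascal m k = begin
    suc m P′ suc k                   ≡⟨ nP′k≡n[n∸1P′k∸1] (suc m) (suc k) ⟩
    suc m * (m P′ k)                 ≡⟨ factor ⟩
    (suc k + (m ∸ k)) * (m P′ k)     ≡⟨ *-distribʳ-+ (m P′ k) (suc k) (m ∸ k) ⟩
    suc k * (m P′ k) + (m P′ suc k)  ∎
    where
    open ≡-Reasoning
    factor : suc m * (m P′ k) ≡ (suc k + (m ∸ k)) * (m P′ k)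
    factor with k ≤? m
    ... | yes k≤m = cong (λ l → suc l * (m P′ k)) (sym (m+[n∸m]≡n k≤m))
    ... | no  k≰m rewrite P′-zero (≰⇒> k≰m) = trans (*-zeroʳ (suc m)) (sym (*-zeroʳ (suc k + (m ∸ k))))

  P′-+ : (n k j : ℕ) → n P′ (k + j) ≡ (n P′ k) * ((n ∸ k) P′ j)
  P′-+ n k zero = trans (cong (n P′_) (+-identityʳ k)) (sym (*-identityʳ (n P′ k)))
  P′-+ n k (suc j) = begin
    n P′ (k + suc j)                              ≡⟨ cong (n P′_) (+-suc k j) ⟩
    (n ∸ (k + j)) * (n P′ (k + j))                ≡⟨ cong₂ _*_ (sym (∸-+-assoc n k j)) (P′-+ n k j) ⟩
    (n ∸ k ∸ j) * ((n P′ k) * ((n ∸ k) P′ j))     ≡⟨ x∙yz≈y∙xz (n ∸ k ∸ j) (n P′ k) _ ⟩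
    (n P′ k) * ((n ∸ k) P′ suc j)                 ∎
    where open ≡-Reasoning

  module _ {A : Set} where

    combinations : ℕ → List A → List (List A)
    combinations zero    xs       = [] ∷ []
    combinations (suc k) []       = []
    combinations (suc k) (x ∷ xs) = map (x ∷_) (combinations k xs) ++ combinations (suc k) xs

    ∈-combinations⁺ : {ds xs : List A} → ds ⊆ xs → ds ∈ combinations (length ds) xs
    ∈-combinations⁺ {[]} _ = here refl
    ∈-combinations⁺ {d ∷ ds} (x ∷ʳ ds⊆xs) = ∈-++⁺ʳ _ (∈-combinations⁺ ds⊆xs)
    ∈-combinations⁺ {d ∷ ds} (refl ∷ ds⊆xs) = ∈-++⁺ˡ (∈-map⁺ (d ∷_) (∈-combinations⁺ ds⊆xs))

    ∈-combinations⁻ : (k : ℕ) (xs : List A) {ds : List A} → ds ∈ combinations k xs → ds ⊆ xs × length ds ≡ k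
    ∈-combinations⁻ zero xs (here refl) = minimum xs , refl
    ∈-combinations⁻ (suc k) (x ∷ xs) ds∈ with ∈-++⁻ (map (x ∷_) (combinations k xs)) ds∈
    ... | inj₂ ds∈′ = let ds⊆ , |ds| = ∈-combinations⁻ (suc k) xs ds∈′ in x ∷ʳ ds⊆ , |ds|
    ... | inj₁ ds∈′ with ds′ , ds′∈ , refl ← ∈-map⁻ (x ∷_) ds∈′ =
      let ds⊆ , |ds| = ∈-combinations⁻ k xs ds′∈ in refl ∷ ds⊆ , cong suc |ds|

    combinations-unique : (k : ℕ) {xs : List A} → Unique xs → Unique (combinations k xs)
    combinations-unique zero _ = [] ∷ []
    combinations-unique (suc k) {[]} _ = []
    combinations-unique (suc k) {x ∷ xs} x∷xs!@(_ ∷ xs!) =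
      Unique.++⁺ (Unique.map⁺ ∷-injectiveʳ (combinations-unique k xs!)) (combinations-unique (suc k) xs!) disjoint
      where
      disjoint : ∀ {ds} → ¬ (ds ∈ map (x ∷_) (combinations k xs) × ds ∈ combinations (suc k) xs)
      disjoint (ds∈ˡ , ds∈ʳ) with ds′ , _ , refl ← ∈-map⁻ (x ∷_) ds∈ˡ =
        Unique.Unique[x∷xs]⇒x∉xs x∷xs! (Any-resp-⊆ (proj₁ (∈-combinations⁻ (suc k) xs ds∈ʳ)) (here refl))

    length-combinations : (k : ℕ) (xs : List A) → length (combinations k xs) * k ! ≡ length xs P′ k
    length-combinations zero xs = refl
    length-combinations (suc k) [] = sym (cong (_* (0 P′ k)) (0∸n≡0 k))
    length-combinations (suc k) (x ∷ xs) = begin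
      length (map (x ∷_) (combinations k xs) ++ combinations (suc k) xs) * (suc k) !
        ≡⟨ cong (_* (suc k) !) (trans (length-++ (map (x ∷_) (combinations k xs)))
                                       (cong (_+ length (combinations (suc k) xs)) (length-map (x ∷_) (combinations k xs)))) ⟩
      (length (combinations k xs) + length (combinations (suc k) xs)) * (suc k * k !)
        ≡⟨ *-distribʳ-+ (suc k * k !) (length (combinations k xs)) _ ⟩
      length (combinations k xs) * (suc k * k !) + length (combinations (suc k) xs) * (suc k) !
        ≡⟨ cong (_+ length (combinations (suc k) xs) * (suc k) !) (x∙yz≈y∙xz (length (combinations k xs)) (suc k) (k !)) ⟩
      suc k * (length (combinations k xs) * k !) + length (combinations (suc k) xs) * (suc k) !
        ≡⟨ cong₂ (λ a b → suc k * a + b) (length-combinations k xs) (length-combinations (suc k) xs) ⟩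
      suc k * (length xs P′ k) + (length xs P′ suc k)
        ≡⟨ P′-pascal (length xs) k ⟨
      suc (length xs) P′ suc k ∎
      where open ≡-Reasoning

module Permutations where

  open import Data.Empty using (⊥-elim)
  open import Data.Fin.Base using (Fin; zero; suc; punchOut)
  open import Data.Fin.Permutation.Components using (transpose; transpose-inverse)
  open import Data.Fin.Properties using (_≟_; any?; punchOut-injective; injective⇒≤)
  open import Data.List.Base as List using (List; []; _∷_; length; concatMap; cartesianProductWith; allFin)
  open import Data.List.Membership.Propositional using (_∈_)
  open import Data.List.Membership.Propositional.Properties using (∈-cartesianProductWith⁺; ∈-allFin; ∈-filter⁺; ∈-filter⁻)
  import Data.List.Membership.DecPropositional as DecMembership
  open import Data.List.Properties using (length-filter; length-tabulate)
  open import Data.List.Relation.Unary.All using ([])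
  import Data.List.Relation.Unary.All as All
  open import Data.List.Relation.Unary.Any using (here)
  open import Data.List.Relation.Unary.Unique.Propositional using (Unique; []; _∷_)
  import Data.List.Relation.Unary.Unique.Propositional.Properties as Unique
  import Data.List.Relation.Unary.Unique.DecPropositional as UniqueDec
  open import Data.Nat.Base using (ℕ; zero; suc; _∸_; _≤_)
  open import Data.Nat.Properties using (1+n≰n; m+n∸m≡n)
  open import Data.Product using (∃; _,_; proj₂)
  open import Data.Vec.Base as Vec using (Vec; []; _∷_; lookup; toList; tabulate)
  open import Data.Vec.Membership.Propositional.Properties using (∈-lookup; ∈-toList⁺)
  open import Data.Vec.Properties using (∷-injective; lookup∘tabulate; tabulate∘lookup; tabulate-cong; lookup-map)
  open import Function.Base using (_∘_; id)
  open import Function.Bundles using (mk⇔; module Equivalence)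
  open import Function.Definitions using (Injective)
  open import Relation.Binary.PropositionalEquality
  open import Relation.Nullary using (yes; no)
  open import Relation.Nullary.Decidable using (T?)
  open import Relation.Unary.Properties using (∁?)
  open Equivalence using (to; from)
  open Counting

  toList-unique⇒lookup-injective : {A : Set} {k : ℕ} (v : Vec A k) → Unique (toList v) → Injective _≡_ _≡_ (lookup v)
  toList-unique⇒lookup-injective (x ∷ v) v! {zero} {zero} _ = refl
  toList-unique⇒lookup-injective (x ∷ v) (x∉v ∷ _) {zero} {suc j} x≡vⱼ =
    ⊥-elim (All.lookup x∉v (∈-toList⁺ (∈-lookup j v)) x≡vⱼ)
  toList-unique⇒lookup-injective (x ∷ v) (x∉v ∷ _) {suc i} {zero} vᵢ≡x =
    ⊥-elim (All.lookup x∉v (∈-toList⁺ (∈-lookup i v)) (sym vᵢ≡x))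
  toList-unique⇒lookup-injective (x ∷ v) (_ ∷ v!) {suc i} {suc j} vᵢ≡vⱼ =
    cong suc (toList-unique⇒lookup-injective v v! vᵢ≡vⱼ)

  toList≡tabulate∘lookup : {A : Set} {k : ℕ} (v : Vec A k) → toList v ≡ List.tabulate (lookup v)
  toList≡tabulate∘lookup [] = refl
  toList≡tabulate∘lookup (x ∷ v) = cong (x ∷_) (toList≡tabulate∘lookup v)

  lookup-injective⇒toList-unique : {A : Set} {k : ℕ} (v : Vec A k) → Injective _≡_ _≡_ (lookup v) → Unique (toList v)
  lookup-injective⇒toList-unique v inj = subst Unique (sym (toList≡tabulate∘lookup v)) (Unique.tabulate⁺ inj)

  lookup-extensionality : {A : Set} {k : ℕ} (u v : Vec A k) → (∀ i → lookup u i ≡ lookup v i) → u ≡ v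
  lookup-extensionality u v u≗v = trans (sym (tabulate∘lookup u)) (trans (tabulate-cong u≗v) (tabulate∘lookup v))

  injective⇒surjective : {n : ℕ} (f : Fin n → Fin n) → Injective _≡_ _≡_ f → ∀ y → ∃ λ i → f i ≡ y
  injective⇒surjective f f-inj y with any? (λ i → f i ≟ y)
  ... | yes hit = hit
  injective⇒surjective {suc n} f f-inj y | no miss = ⊥-elim (1+n≰n (injective⇒≤ g-inj))
    where
    y≢f : ∀ i → y ≢ f i
    y≢f i y≡fi = miss (i , sym y≡fi)
    g : Fin (suc n) → Fin n
    g i = punchOut (y≢f i)
    g-inj : Injective _≡_ _≡_ g
    g-inj gi≡gj = f-inj (punchOut-injective (y≢f _) (y≢f _) gi≡gj)

  concatMap-map≡cartesianProductWith : {A B C : Set} (f : A → B → C) (xs : List A) (ys : List B) →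
                                       concatMap (λ x → List.map (f x) ys) xs ≡ cartesianProductWith f xs ys
  concatMap-map≡cartesianProductWith f [] ys = refl
  concatMap-map≡cartesianProductWith f (x ∷ xs) ys =
    cong (List.map (f x) ys List.++_) (concatMap-map≡cartesianProductWith f xs ys)

  module _ {n : ℕ} where

    open DecMembership (_≟_ {n}) using (_∈?_)

    ∈-allVecs : {k : ℕ} (v : Vec (Fin n) k) → v ∈ allVecs n k
    ∈-allVecs [] = here refl
    ∈-allVecs {suc k} (x ∷ v) =
      subst (x ∷ v ∈_) (sym (concatMap-map≡cartesianProductWith _∷_ (allFin n) (allVecs n k)))
            (∈-cartesianProductWith⁺ _∷_ (∈-allFin x) (∈-allVecs v))

    allVecs-unique : (k : ℕ) → Unique (allVecs n k)
    allVecs-unique zero = [] ∷ []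
    allVecs-unique (suc k) =
      subst Unique (sym (concatMap-map≡cartesianProductWith _∷_ (allFin n) (allVecs n k)))
            (Unique.cartesianProductWith⁺ _∷_ ∷-injective (Unique.allFin⁺ n) (allVecs-unique k))

    ∈-Sym⁻ : {σ : Vec (Fin n) n} → σ ∈ Sym n → Injective _≡_ _≡_ (lookup σ)
    ∈-Sym⁻ {σ} σ∈ = toList-unique⇒lookup-injective σ
      (to (T-does⇔ (UniqueDec.unique? _≟_ (toList σ))) (proj₂ (∈-filter⁻ (T? ∘ isPerm) {xs = allVecs n n} σ∈)))

    ∈-Sym⁺ : {σ : Vec (Fin n) n} → Injective _≡_ _≡_ (lookup σ) → σ ∈ Sym n
    ∈-Sym⁺ {σ} inj = ∈-filter⁺ (T? ∘ isPerm) (∈-allVecs σ)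
      (from (T-does⇔ (UniqueDec.unique? _≟_ (toList σ))) (lookup-injective⇒toList-unique σ inj))

    Sym-unique : Unique (Sym n)
    Sym-unique = Unique.filter⁺ (T? ∘ isPerm) (allVecs-unique n)

    map-∈-Sym : {f : Fin n → Fin n} → Injective _≡_ _≡_ f → {σ : Vec (Fin n) n} → σ ∈ Sym n → Vec.map f σ ∈ Sym n
    map-∈-Sym {f} f-inj {σ} σ∈ = ∈-Sym⁺ λ {i} {j} eq →
      ∈-Sym⁻ σ∈ (f-inj (trans (sym (lookup-map i f σ)) (trans eq (lookup-map j f σ))))

    -- A value without preimage (possible only outside Sym n) is sent to itself.
    inverse : Vec (Fin n) n → Fin n → Fin n
    inverse σ y with any? (λ i → lookup σ i ≟ y)
    ... | yes (i , _) = i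
    ... | no _        = y

    _⁻¹ : Vec (Fin n) n → Vec (Fin n) n
    σ ⁻¹ = tabulate (inverse σ)

    conj : Vec (Fin n) n → Vec (Fin n) n → Vec (Fin n) n
    conj σ π = tabulate (λ j → lookup σ (lookup π (inverse σ j)))

    module _ (σ : Vec (Fin n) n) (σ-inj : Injective _≡_ _≡_ (lookup σ)) where

      lookup∘inverse : ∀ y → lookup σ (inverse σ y) ≡ y
      lookup∘inverse y with any? (λ i → lookup σ i ≟ y)
      ... | yes (_ , σi≡y) = σi≡y
      ... | no miss        = ⊥-elim (miss (injective⇒surjective (lookup σ) σ-inj y))

      inverse∘lookup : ∀ i → inverse σ (lookup σ i) ≡ i
      inverse∘lookup i = σ-inj (lookup∘inverse (lookup σ i))

      inverse-injective : Injective _≡_ _≡_ (inverse σ)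
      inverse-injective {x} {y} σ⁻¹x≡σ⁻¹y =
        trans (sym (lookup∘inverse x)) (trans (cong (lookup σ) σ⁻¹x≡σ⁻¹y) (lookup∘inverse y))

      ⁻¹-injective : Injective _≡_ _≡_ (lookup (σ ⁻¹))
      ⁻¹-injective {x} {y} eq =
        inverse-injective (trans (sym (lookup∘tabulate (inverse σ) x)) (trans eq (lookup∘tabulate (inverse σ) y)))

    module _ (σ : Vec (Fin n) n) (σ-inj : Injective _≡_ _≡_ (lookup σ)) where

      lookup-conj : (π : Vec (Fin n) n) (i : Fin n) → lookup (conj σ π) (lookup σ i) ≡ lookup σ (lookup π i)
      lookup-conj π i = trans (lookup∘tabulate _ (lookup σ i)) (cong (lookup σ ∘ lookup π) (inverse∘lookup σ σ-inj i))

      conj-∈-Sym : {π : Vec (Fin n) n} → π ∈ Sym n → conj σ π ∈ Sym n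
      conj-∈-Sym {π} π∈ = ∈-Sym⁺ λ {x} {y} eq → inverse-injective σ σ-inj (∈-Sym⁻ π∈ (σ-inj
        (trans (sym (lookup∘tabulate _ x)) (trans eq (lookup∘tabulate _ y)))))

      conj-injective : Injective _≡_ _≡_ (conj σ)
      conj-injective {π} {π′} eq = lookup-extensionality π π′ λ i → σ-inj
        (trans (sym (lookup-conj π i)) (trans (cong (λ ρ → lookup ρ (lookup σ i)) eq) (lookup-conj π′ i)))

      conj-conj⁻¹ : (ρ : Vec (Fin n) n) → conj σ (conj (σ ⁻¹) ρ) ≡ ρ
      conj-conj⁻¹ ρ = lookup-extensionality _ ρ λ j → begin
        lookup (conj σ (conj (σ ⁻¹) ρ)) j
          ≡⟨ lookup∘tabulate _ j ⟩
        lookup σ (lookup (conj (σ ⁻¹) ρ) (inverse σ j))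
          ≡⟨ cong (lookup σ) (lookup∘tabulate _ (inverse σ j)) ⟩
        lookup σ (lookup (σ ⁻¹) (lookup ρ (inverse (σ ⁻¹) (inverse σ j))))
          ≡⟨ cong (λ i → lookup σ (lookup (σ ⁻¹) (lookup ρ i))) (σ⁻¹⁻¹ j) ⟩
        lookup σ (lookup (σ ⁻¹) (lookup ρ j))
          ≡⟨ cong (lookup σ) (lookup∘tabulate _ (lookup ρ j)) ⟩
        lookup σ (inverse σ (lookup ρ j))
          ≡⟨ lookup∘inverse σ σ-inj (lookup ρ j) ⟩
        lookup ρ j ∎
        where
        open ≡-Reasoning
        σ⁻¹⁻¹ : ∀ j → inverse (σ ⁻¹) (inverse σ j) ≡ j
        σ⁻¹⁻¹ j = trans (cong (inverse (σ ⁻¹)) (sym (lookup∘tabulate (inverse σ) j)))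
                        (inverse∘lookup (σ ⁻¹) (⁻¹-injective σ σ-inj) j)

    transpose-matchˡ : (i j : Fin n) → transpose i j i ≡ j
    transpose-matchˡ i j with i ≟ i
    ... | yes _  = refl
    ... | no i≢i = ⊥-elim (i≢i refl)

    transpose-fixes : {i j k : Fin n} → k ≢ i → k ≢ j → transpose i j k ≡ k
    transpose-fixes {i} {j} {k} k≢i k≢j with k ≟ i
    ... | yes k≡i = ⊥-elim (k≢i k≡i)
    ... | no _ with k ≟ j
    ...   | yes k≡j = ⊥-elim (k≢j k≡j)
    ...   | no _    = refl

    transpose-injective : (i j : Fin n) → Injective _≡_ _≡_ (transpose i j)
    transpose-injective i j {x} {y} eq =
      trans (sym (transpose-inverse j i)) (trans (cong (transpose j i) eq) (transpose-inverse j i))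

    count-∈-allFin : {vs : List (Fin n)} → Unique vs → count (_∈? vs) (allFin n) ≡ length vs
    count-∈-allFin {vs} vs! = unique∧set⇒length≡ (Unique.filter⁺ (_∈? vs) (Unique.allFin⁺ n)) vs!
      (mk⇔ (proj₂ ∘ ∈-filter⁻ (_∈? vs) {xs = allFin n}) (λ v∈vs → ∈-filter⁺ (_∈? vs) (∈-allFin _) v∈vs))

    count-∉-allFin : {vs : List (Fin n)} → Unique vs → count (∁? (_∈? vs)) (allFin n) ≡ n ∸ length vs
    count-∉-allFin {vs} vs! =
      trans (sym (m+n∸m≡n (count (_∈? vs) (allFin n)) _))
            (cong₂ _∸_ (trans (count+count-∁ (_∈? vs) (allFin n)) (length-tabulate {n = n} id)) (count-∈-allFin vs!))

    unique⇒length≤ : {vs : List (Fin n)} → Unique vs → length vs ≤ n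
    unique⇒length≤ {vs} vs! =
      subst₂ _≤_ (count-∈-allFin vs!) (length-tabulate {n = n} id) (length-filter (_∈? vs) (allFin n))

module CountingPermutations where

  open import Data.Bool.Base using (T)
  open import Data.Fin.Base using (Fin)
  import Data.Fin.Properties as Fin
  open import Data.Fin.Properties using (_≟_)
  open import Data.Fin.Permutation.Components using (transpose; transpose-inverse)
  open import Data.List.Base as List using (List; []; _∷_; length; _++_; allFin; filter)
  open import Data.List.Membership.Propositional using (_∈_; _∉_)
  open import Data.List.Membership.Propositional.Properties using (∈-map⁻; ∈-allFin; ∈-filter⁺; ∈-filter⁻)
  import Data.List.Membership.DecPropositional as DecMembership
  open import Data.List.Properties
    using (∷-injective; ≡-dec; map-cong; map-∘; map-id; map-injective; map-id-local; map-++; map-tabulate; length-map; length-++; filter-all)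
  open import Data.List.Relation.Binary.Disjoint.Propositional using (Disjoint)
  open import Data.List.Relation.Binary.Sublist.Propositional using (_⊆_)
  import Data.List.Relation.Binary.Sublist.Propositional.Properties as Sublist
  import Data.List.Relation.Binary.Sublist.DecPropositional as SublistDec
  open import Data.List.Relation.Unary.All as All using (All)
  open import Data.List.Relation.Unary.AllPairs using (allPairs?)
  import Data.List.Relation.Unary.AllPairs as AllPairs
  import Data.List.Relation.Unary.AllPairs.Properties as AllPairs
  open import Data.List.Relation.Unary.Unique.Propositional using (Unique; _∷_)
  import Data.List.Relation.Unary.Unique.Propositional.Properties as Unique
  open import Data.Nat.Base using (ℕ; _+_; _*_; _∸_; _!; _≤_; NonZero)
  open import Data.Nat.Combinatorics.Base using (_P′_)
  open import Data.Nat.Properties hiding (_≟_)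
  open import Data.Nat.Solver using (module +-*-Solver)
  open import Data.Product using (_×_; _,_; proj₁; proj₂)
  open import Data.Vec.Base as Vec using (Vec; lookup; toList)
  open import Data.Vec.Properties using (lookup-map) renaming (map-∘ to map-∘ᵥ; map-cong to map-congᵥ; map-id to map-idᵥ)
  open import Function.Base using (_∘_; id)
  open import Function.Bundles using (_⇔_; mk⇔; module Equivalence)
  open import Function.Definitions using (Injective)
  open import Level using (0ℓ)
  open import Relation.Binary.PropositionalEquality
  open import Relation.Nullary using (_×-dec_; decidable-stable)
  open import Relation.Unary using (Pred; Decidable)
  open import Relation.Unary.Properties using (∁?; _∩?_)
  open +-*-Solver using (solve; _:*_; _:=_)
  open Equivalence using (to; from)
  open Counting
  open SortedSublists
  open Permutations

  ++-injective : {A : Set} {xs ys zs ws : List A} → length xs ≡ length ys → xs ++ zs ≡ ys ++ ws → xs ≡ ys × zs ≡ ws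
  ++-injective {xs = []} {[]} _ eq = refl , eq
  ++-injective {xs = x ∷ xs} {y ∷ ys} |xs|≡|ys| eq =
    let x≡y , rest = ∷-injective eq ; xs≡ys , zs≡ws = ++-injective (suc-injective |xs|≡|ys|) rest
    in cong₂ _∷_ x≡y xs≡ys , zs≡ws

  module _ {n : ℕ} where

    open DecMembership (_≟_ {n}) using (_∈?_)

    Sends : List (Fin n) → List (Fin n) → Pred (Vec (Fin n) n) 0ℓ
    Sends us vs σ = List.map (lookup σ) us ≡ vs

    sends? : (us vs : List (Fin n)) → Decidable (Sends us vs)
    sends? us vs σ = ≡-dec _≟_ (List.map (lookup σ) us) vs

    module _ {u v : Fin n} {us vs : List (Fin n)} where

      Sends-transpose : {z : Fin n} → v ∉ vs → z ∉ vs → (σ : Vec (Fin n) n) →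
                        Sends (u ∷ us) (v ∷ vs) (Vec.map (transpose z v) σ) ⇔ (Sends us vs σ × lookup σ u ≡ z)
      Sends-transpose {z} v∉vs z∉vs σ = mk⇔
        (λ eq → let tσu≡v , tσus≡vs = ∷-injective (trans (sym map-tσ) eq) in
          map-injective (transpose-injective z v) (trans tσus≡vs (sym t-fixes-vs)) ,
          transpose-injective z v (trans tσu≡v (sym (transpose-matchˡ z v))))
        (λ (σus≡vs , σu≡z) → trans map-tσ
          (cong₂ _∷_ (trans (cong t σu≡z) (transpose-matchˡ z v)) (trans (cong (List.map t) σus≡vs) t-fixes-vs)))
        where
        t : Fin n → Fin n
        t = transpose z v
        map-tσ : List.map (lookup (Vec.map t σ)) (u ∷ us) ≡ t (lookup σ u) ∷ List.map t (List.map (lookup σ) us)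
        map-tσ = trans (map-cong (λ x → lookup-map x t σ) (u ∷ us)) (map-∘ (u ∷ us))
        t-fixes-vs : List.map t vs ≡ vs
        t-fixes-vs = map-id-local (All.tabulate λ {w} w∈vs →
          transpose-fixes (λ w≡z → z∉vs (subst (_∈ vs) w≡z w∈vs)) (λ w≡v → v∉vs (subst (_∈ vs) w≡v w∈vs)))

      fibre-transpose : {z : Fin n} → v ∉ vs → z ∉ vs →
                        count (sends? us vs ∩? (λ σ → lookup σ u ≟ z)) (Sym n) ≡ count (sends? (u ∷ us) (v ∷ vs)) (Sym n)
      fibre-transpose {z} v∉vs z∉vs =
        trans (count-cong _ (sends? (u ∷ us) (v ∷ vs) ∘ Vec.map t) (Sym n)
                          (λ {σ} _ → from (Sends-transpose v∉vs z∉vs σ)) (λ {σ} _ → to (Sends-transpose v∉vs z∉vs σ)))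
              (count-bijection (sends? (u ∷ us) (v ∷ vs)) (Vec.map t) (Vec.map t′) Sym-unique Sym-unique map-t-injective
                               (map-∈-Sym (transpose-injective z v)) (map-∈-Sym (transpose-injective v z)) (λ {ρ} _ → t∘t′ ρ))
        where
        t t′ : Fin n → Fin n
        t = transpose z v
        t′ = transpose v z
        map-t-injective : Injective _≡_ _≡_ (Vec.map t)
        map-t-injective {σ} {σ′} eq = lookup-extensionality σ σ′ λ i → transpose-injective z v
          (trans (sym (lookup-map i t σ)) (trans (cong (λ ρ → lookup ρ i) eq) (lookup-map i t σ′)))
        t∘t′ : (ρ : Vec (Fin n) n) → Vec.map t (Vec.map t′ ρ) ≡ ρ
        t∘t′ ρ = trans (sym (map-∘ᵥ t t′ ρ)) (trans (map-congᵥ (λ _ → transpose-inverse z v) ρ) (map-idᵥ ρ))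

      fibre-occupied : {z : Fin n} → u ∉ us → z ∈ vs → count (sends? us vs ∩? (λ σ → lookup σ u ≟ z)) (Sym n) ≡ 0
      fibre-occupied {z} u∉us z∈vs = count-none _ (Sym n) λ {σ} σ∈ (σus≡vs , σu≡z) →
        let u′ , u′∈us , z≡σu′ = ∈-map⁻ (lookup σ) (subst (z ∈_) (sym σus≡vs) z∈vs) in
        u∉us (subst (_∈ us) (sym (∈-Sym⁻ σ∈ (trans σu≡z z≡σu′))) u′∈us)

      count-Sends-step : u ∉ us → v ∉ vs → Unique vs →
                         count (sends? us vs) (Sym n) ≡ (n ∸ length vs) * count (sends? (u ∷ us) (v ∷ vs)) (Sym n)
      count-Sends-step u∉us v∉vs vs! = begin
        count (sends? us vs) (Sym n)
          ≡⟨ count-fibres _≟_ (sends? us vs) (λ σ → lookup σ u) (Sym n) (Unique.allFin⁺ n) (λ _ _ → ∈-allFin _) ⟩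
        ∑[ z ∈ allFin n ] count (sends? us vs ∩? (λ σ → lookup σ u ≟ z)) (Sym n)
          ≡⟨ ∑-indicator (∁? (_∈? vs)) (allFin n) _ _ (λ _ → fibre-transpose v∉vs)
                                                      (λ _ → fibre-occupied u∉us ∘ decidable-stable (_ ∈? vs)) ⟩
        count (∁? (_∈? vs)) (allFin n) * count (sends? (u ∷ us) (v ∷ vs)) (Sym n)
          ≡⟨ cong (_* count (sends? (u ∷ us) (v ∷ vs)) (Sym n)) (count-∉-allFin vs!) ⟩
        (n ∸ length vs) * count (sends? (u ∷ us) (v ∷ vs)) (Sym n) ∎
        where open ≡-Reasoning

    count-Sends : (us vs : List (Fin n)) → Unique us → Unique vs → length us ≡ length vs →
                  count (sends? us vs) (Sym n) * (n P′ length us) ≡ length (Sym n)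
    count-Sends [] [] _ _ _ =
      trans (*-identityʳ _) (cong length (filter-all (sends? [] []) {xs = Sym n} (All.universal (λ _ → refl) (Sym n))))
    count-Sends (u ∷ us) (v ∷ vs) u∷us!@(_ ∷ us!) v∷vs!@(_ ∷ vs!) |us|≡|vs| = begin
      X * ((n ∸ length us) * (n P′ length us))  ≡⟨ reorder X (n ∸ length us) (n P′ length us) ⟩
      (n ∸ length us) * X * (n P′ length us)    ≡⟨ cong (λ m → (n ∸ m) * X * _) (suc-injective |us|≡|vs|) ⟩
      (n ∸ length vs) * X * (n P′ length us)    ≡⟨ cong (_* _) (count-Sends-step u∉us v∉vs vs!) ⟨
      count (sends? us vs) (Sym n) * (n P′ length us) ≡⟨ count-Sends us vs us! vs! (suc-injective |us|≡|vs|) ⟩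
      length (Sym n)                          ∎
      where
      open ≡-Reasoning
      X : ℕ
      X = count (sends? (u ∷ us) (v ∷ vs)) (Sym n)
      u∉us : u ∉ us
      u∉us = Unique.Unique[x∷xs]⇒x∉xs u∷us!
      v∉vs : v ∉ vs
      v∉vs = Unique.Unique[x∷xs]⇒x∉xs v∷vs!
      reorder : ∀ a b c → a * (b * c) ≡ b * a * c
      reorder a b c = trans (sym (*-assoc a b c)) (cong (_* c) (*-comm a b))

    increasing? : Decidable (Increasing {n})
    increasing? = allPairs? Fin._<?_

    module _ {us vs ws : List (Fin n)} (us! : Unique us) (ws! : Unique ws) (us#ws : Disjoint us ws)
             (vs! : Unique vs) (|us|≡|vs| : length us ≡ length vs) where

      private
        m k : ℕ
        m = length us
        k = length ws

        image : Vec (Fin n) n → List (Fin n)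
        image σ = List.map (lookup σ) ws

        image≟ : (ds : List (Fin n)) → Decidable (λ σ → image σ ≡ ds)
        image≟ ds σ = ≡-dec _≟_ (image σ) ds

        sorted? : Decidable (λ σ → Sends us vs σ × Increasing (image σ))
        sorted? σ = sends? us vs σ ×-dec increasing? (image σ)

        avoiding : List (Fin n)
        avoiding = filter (∁? (_∈? vs)) (allFin n)

        candidates : List (List (Fin n))
        candidates = combinations k avoiding

        avoiding-increasing : Increasing avoiding
        avoiding-increasing = AllPairs.filter⁺ (∁? (_∈? vs)) (AllPairs.tabulate⁺-< id)

        candidate-facts : ∀ {ds} → ds ∈ candidates → Increasing ds × All (_∉ vs) ds × length ds ≡ k
        candidate-facts ds∈ =
          let ds⊆ , |ds| = ∈-combinations⁻ k avoiding ds∈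
              ds-incr , ds∈avoiding = to (⊆-sorted⇔ Fin.<-irrefl Fin.<-trans avoiding-increasing) ds⊆
          in ds-incr , All.map (proj₂ ∘ ∈-filter⁻ (∁? (_∈? vs)) {xs = allFin n}) ds∈avoiding , |ds|

        image∈candidates : ∀ {σ} → σ ∈ Sym n → Sends us vs σ × Increasing (image σ) → image σ ∈ candidates
        image∈candidates {σ} σ∈ (σus≡vs , incr) = subst (λ l → image σ ∈ combinations l avoiding) (length-map _ ws)
          (∈-combinations⁺ (from (⊆-sorted⇔ Fin.<-irrefl Fin.<-trans avoiding-increasing) (incr , All.tabulate avoids)))
          where
          avoids : ∀ {y} → y ∈ image σ → y ∈ avoiding
          avoids y∈ with w , w∈ws , refl ← ∈-map⁻ (lookup σ) y∈ = ∈-filter⁺ (∁? (_∈? vs)) (∈-allFin _) λ σw∈vs →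
            let u , u∈us , σw≡σu = ∈-map⁻ (lookup σ) (subst (_ ∈_) (sym σus≡vs) σw∈vs)
            in us#ws (subst (_∈ us) (sym (∈-Sym⁻ σ∈ σw≡σu)) u∈us , w∈ws)

        fibre : ∀ {ds} → ds ∈ candidates → count (sorted? ∩? image≟ ds) (Sym n) * (n P′ (m + k)) ≡ length (Sym n)
        fibre {ds} ds∈ = begin
          count (sorted? ∩? image≟ ds) (Sym n) * (n P′ (m + k))
            ≡⟨ cong₂ _*_ (count-cong _ _ (Sym n) (λ {σ} _ → joined {σ}) (λ {σ} _ → split {σ}))
                         (cong (n P′_) (sym (length-++ us))) ⟩
          count (sends? (us ++ ws) (vs ++ ds)) (Sym n) * (n P′ length (us ++ ws))
            ≡⟨ count-Sends (us ++ ws) (vs ++ ds) (Unique.++⁺ us! ws! us#ws) vs++ds! lengths ⟩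
          length (Sym n) ∎
          where
          open ≡-Reasoning
          facts : Increasing ds × All (_∉ vs) ds × length ds ≡ k
          facts = candidate-facts ds∈
          ds-incr : Increasing ds
          ds-incr = proj₁ facts
          vs++ds! : Unique (vs ++ ds)
          vs++ds! = Unique.++⁺ vs! (AllPairs.map Fin.<⇒≢ ds-incr)
                               λ (v∈vs , v∈ds) → All.lookup (proj₁ (proj₂ facts)) v∈ds v∈vs
          lengths : length (us ++ ws) ≡ length (vs ++ ds)
          lengths = trans (length-++ us) (trans (cong₂ _+_ |us|≡|vs| (sym (proj₂ (proj₂ facts)))) (sym (length-++ vs)))
          joined : ∀ {σ} → (Sends us vs σ × Increasing (image σ)) × image σ ≡ ds → Sends (us ++ ws) (vs ++ ds) σ
          joined {σ} ((σus≡vs , _) , σws≡ds) = trans (map-++ (lookup σ) us ws) (cong₂ _++_ σus≡vs σws≡ds)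
          split : ∀ {σ} → Sends (us ++ ws) (vs ++ ds) σ → (Sends us vs σ × Increasing (image σ)) × image σ ≡ ds
          split {σ} eq =
            let σus≡vs , σws≡ds = ++-injective (trans (length-map (lookup σ) us) |us|≡|vs|)
                                               (trans (sym (map-++ (lookup σ) us ws)) eq)
            in (σus≡vs , subst Increasing (sym σws≡ds) ds-incr) , σws≡ds

      -- Fibring over the values on ws: the increasing candidates are the k-sublists of the (n − m) values
      -- avoiding vs, so there are (n − m) P′ k / k! of them; each fibre has n! / (n P′ (m + k)) elements,
      -- and n P′ (m + k) = n P′ m · (n − m) P′ k.
      count-Sends×Increasing : count (λ σ → sends? us vs σ ×-dec increasing? (List.map (lookup σ) ws)) (Sym n) * length ws !
                               ≡ count (sends? us vs) (Sym n)
      count-Sends×Increasing =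
        *-cancelʳ-≡ (X * k !) Z ((n P′ m) * C) {{m*n≢0 (n P′ m) C {{P′-nonZero m≤n}} {{C≢0}}}} (begin
        X * k ! * ((n P′ m) * C)
          ≡⟨ solve 4 (λ x f p c → x :* f :* (p :* c) := x :* (p :* (c :* f))) refl X (k !) (n P′ m) C ⟩
        X * ((n P′ m) * (C * k !))
          ≡⟨ cong (λ t → X * ((n P′ m) * t)) candidates-length ⟩
        X * ((n P′ m) * ((n ∸ m) P′ k))
          ≡⟨ cong (X *_) (P′-+ n m k) ⟨
        X * (n P′ (m + k))
          ≡⟨ scaled ⟩
        C * length (Sym n)
          ≡⟨ cong (C *_) (count-Sends us vs us! vs! |us|≡|vs|) ⟨
        C * (Z * (n P′ m))
          ≡⟨ solve 3 (λ c z p → c :* (z :* p) := z :* (p :* c)) refl C Z (n P′ m) ⟩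
        Z * ((n P′ m) * C) ∎)
        where
        open ≡-Reasoning
        X Z C : ℕ
        X = count sorted? (Sym n)
        Z = count (sends? us vs) (Sym n)
        C = length candidates
        m+k≤n : m + k ≤ n
        m+k≤n = subst (_≤ n) (length-++ us) (unique⇒length≤ (Unique.++⁺ us! ws! us#ws))
        m≤n : m ≤ n
        m≤n = m+n≤o⇒m≤o m m+k≤n
        candidates-length : C * k ! ≡ (n ∸ m) P′ k
        candidates-length = trans (length-combinations k avoiding)
          (cong (_P′ k) (trans (count-∉-allFin vs!) (cong (n ∸_) (sym |us|≡|vs|))))
        C≢0 : NonZero C
        C≢0 = m*n≢0⇒m≢0 C {{subst NonZero (sym candidates-length)
                (P′-nonZero (subst (_≤ n ∸ m) (m+n∸m≡n m k) (∸-monoˡ-≤ m m+k≤n)))}}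
        scaled : X * (n P′ (m + k)) ≡ C * length (Sym n)
        scaled = begin
          X * (n P′ (m + k))
            ≡⟨ cong (_* (n P′ (m + k))) (count-fibres (≡-dec _≟_) sorted? image (Sym n)
                   (combinations-unique k (Unique.filter⁺ (∁? (_∈? vs)) (Unique.allFin⁺ n))) image∈candidates) ⟩
          (∑[ ds ∈ candidates ] count (sorted? ∩? image≟ ds) (Sym n)) * (n P′ (m + k))
            ≡⟨ ∑-*ʳ candidates _ (n P′ (m + k)) ⟨
          ∑[ ds ∈ candidates ] (count (sorted? ∩? image≟ ds) (Sym n) * (n P′ (m + k)))
            ≡⟨ ∑-cong candidates fibre ⟩
          ∑[ ds ∈ candidates ] length (Sym n)
            ≡⟨ ∑-const candidates (length (Sym n)) ⟩
          C * length (Sym n) ∎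

  module _ {n k : ℕ} (τ : Vec (Fin n) k) (ρ : Vec (Fin n) n) {g : Fin n → Fin n}
           (g∘ρ : ∀ i → g (lookup ρ i) ≡ i) (ρ∘g : ∀ x → lookup ρ (g x) ≡ x) where

    -- Mapping by g = ρ⁻¹ turns ρ into allFin n, so τ is a sublist of ρ iff its positions increase.
    hasSubseq⇔Increasing : T (hasSubseq τ ρ) ⇔ Increasing (List.map g (toList τ))
    hasSubseq⇔Increasing = mk⇔
      (λ τ⊆ρ → to ⊆-allFin⇔Increasing (subst (List.map g (toList τ) ⊆_) g-image (Sublist.map⁺ g (to ⊆? τ⊆ρ))))
      (λ incr → from ⊆? (subst₂ _⊆_ ρ∘g-τ ρ-image (Sublist.map⁺ (lookup ρ) (from ⊆-allFin⇔Increasing incr))))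
      where
      ⊆? : T (hasSubseq τ ρ) ⇔ toList τ ⊆ toList ρ
      ⊆? = T-does⇔ (SublistDec._⊆?_ (_≟_ {n}) (toList τ) (toList ρ))
      ρ-image : List.map (lookup ρ) (allFin n) ≡ toList ρ
      ρ-image = trans (map-tabulate id (lookup ρ)) (sym (toList≡tabulate∘lookup ρ))
      g-image : List.map g (toList ρ) ≡ allFin n
      g-image = begin
        List.map g (toList ρ)                       ≡⟨ cong (List.map g) ρ-image ⟨
        List.map g (List.map (lookup ρ) (allFin n)) ≡⟨ map-∘ (allFin n) ⟨
        List.map (g ∘ lookup ρ) (allFin n)          ≡⟨ map-cong g∘ρ (allFin n) ⟩
        List.map id (allFin n)                      ≡⟨ map-id (allFin n) ⟩
        allFin n                                    ∎
        where open ≡-Reasoning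
      ρ∘g-τ : List.map (lookup ρ) (List.map g (toList τ)) ≡ toList τ
      ρ∘g-τ = trans (sym (map-∘ (toList τ))) (trans (map-cong ρ∘g (toList τ)) (map-id (toList τ)))

module RandomConjugate where

  open import Data.Bool.Base using (T)
  open import Data.Fin.Base using (Fin)
  open import Data.Fin.Properties using (_≟_)
  open import Data.List.Base as List using (List; []; _∷_; length; allFin; filter)
  open import Data.List.Membership.Propositional using (_∈_; lose; find)
  open import Data.List.Membership.Propositional.Properties using (∈-map⁻; ∈-map⁺; ∈-allFin; ∈-filter⁺; ∈-filter⁻)
  import Data.List.Membership.DecPropositional as DecMembership
  open import Data.List.Properties
    using (length-filter; ∷-injectiveˡ; ∷-injectiveʳ; ≡-dec; map-∘; map-cong; map-id; length-map; length-tabulate)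
  open import Data.List.Relation.Binary.Disjoint.Propositional using (Disjoint)
  import Data.List.Relation.Binary.Disjoint.DecPropositional as DisjointDec
  open import Data.List.Relation.Unary.All using ([]; _∷_)
  open import Data.List.Relation.Unary.AllPairs using ([]; _∷_)
  open import Data.List.Relation.Unary.Any using (Any; any?)
  open import Data.List.Relation.Unary.Unique.Propositional using (Unique)
  import Data.List.Relation.Unary.Unique.DecPropositional as UniqueDec
  import Data.List.Relation.Unary.Unique.Propositional.Properties as Unique
  open import Data.Nat.Base using (ℕ; _*_; _+_; _∸_; _!; _≤_; z≤n)
  open import Data.Nat.Combinatorics.Base using (_P′_)
  open import Data.Nat.Properties hiding (_≟_)
  open import Algebra.Properties.CommutativeSemigroup *-commutativeSemigroup using (x∙yz≈xz∙y)
  open import Data.Product using (_×_; _,_; proj₁; proj₂)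
  open import Data.Vec.Base as Vec using (Vec; lookup; toList)
  open import Data.Vec.Properties using (lookup∘tabulate; toList-map; toList-injective; length-toList)
  open import Data.Vec.Relation.Binary.Equality.Cast using (cast-is-id)
  open import Function.Base using (_∘_; id)
  open import Function.Bundles using (_⇔_; mk⇔; module Equivalence)
  open import Function.Definitions using (Injective)
  open import Level using (0ℓ)
  open import Relation.Binary.Definitions using (DecidableEquality)
  open import Relation.Binary.PropositionalEquality
  open import Relation.Nullary using (yes; no; ¬_; _×-dec_)
  open import Relation.Nullary.Decidable using (T?)
  open import Relation.Unary using (Pred; Decidable)
  open import Relation.Unary.Properties using (∁?; _∩?_)
  open Equivalence using (to; from)
  open Counting
  open SortedSublists
  open Permutations
  open CountingPermutations

  module _ {n : ℕ} (π : Vec (Fin n) n) where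

    private
      π⁻¹ : Fin n → Fin n
      π⁻¹ = inverse π

    conj⁻¹ : Vec (Fin n) n → Fin n → Fin n
    conj⁻¹ σ x = lookup σ (π⁻¹ (inverse σ x))

    module _ (π∈ : π ∈ Sym n) where

      private
        π-inj : Injective _≡_ _≡_ (lookup π)
        π-inj = ∈-Sym⁻ π∈

      count-fixed-inverse≡fix : count (λ w → π⁻¹ w ≟ w) (allFin n) ≡ fix π
      count-fixed-inverse≡fix = count-cong _ _ (allFin n)
        (λ {w} _ π⁻¹w≡w → from (T-does⇔ (lookup π w ≟ w))
                                 (trans (cong (lookup π) (sym π⁻¹w≡w)) (lookup∘inverse π π-inj w)))
        (λ {w} _ πw≡w → trans (cong π⁻¹ (sym (to (T-does⇔ (lookup π w ≟ w)) πw≡w))) (inverse∘lookup π π-inj w))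

      module _ (x y : Fin n) where

        pair-fibre⇔ : (w : Fin n) → ∀ {σ} → σ ∈ Sym n →
                      (conj⁻¹ σ x ≡ y × inverse σ x ≡ w) ⇔ Sends (w ∷ π⁻¹ w ∷ []) (x ∷ y ∷ []) σ
        pair-fibre⇔ w {σ} σ∈ = mk⇔
          (λ (σπ⁻¹σ⁻¹x≡y , σ⁻¹x≡w) →
             cong₂ _∷_ (trans (cong (lookup σ) (sym σ⁻¹x≡w)) (lookup∘inverse σ σ-inj x))
                       (cong (_∷ []) (trans (cong (lookup σ ∘ π⁻¹) (sym σ⁻¹x≡w)) σπ⁻¹σ⁻¹x≡y)))
          (λ σws≡xy →
             let σ⁻¹x≡w = trans (cong (inverse σ) (sym (∷-injectiveˡ σws≡xy))) (inverse∘lookup σ σ-inj w)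
             in trans (cong (lookup σ ∘ π⁻¹) σ⁻¹x≡w) (∷-injectiveˡ (∷-injectiveʳ σws≡xy)) , σ⁻¹x≡w)
          where
          σ-inj : Injective _≡_ _≡_ (lookup σ)
          σ-inj = ∈-Sym⁻ σ∈

        pair-fibre≡Sends : (w : Fin n) → count ((λ σ → conj⁻¹ σ x ≟ y) ∩? (λ σ → inverse σ x ≟ w)) (Sym n)
                                          ≡ count (sends? (w ∷ π⁻¹ w ∷ []) (x ∷ y ∷ [])) (Sym n)
        pair-fibre≡Sends w = count-cong _ _ (Sym n) (λ σ∈ → to (pair-fibre⇔ w σ∈)) (λ σ∈ → from (pair-fibre⇔ w σ∈))

        pair-fibre-bound : (w : Fin n) →
                           count ((λ σ → conj⁻¹ σ x ≟ y) ∩? (λ σ → inverse σ x ≟ w)) (Sym n) * (n P′ 2)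
                           ≤ 𝟙 (π⁻¹ w ≟ w) * (length (Sym n) * (n ∸ 1)) + length (Sym n)
        pair-fibre-bound w with π⁻¹ w ≟ w
        ... | yes _ = begin
          count ((λ σ → conj⁻¹ σ x ≟ y) ∩? (λ σ → inverse σ x ≟ w)) (Sym n) * ((n ∸ 1) * (n P′ 1))
            ≡⟨ cong (_* _) (pair-fibre≡Sends w) ⟩
          count (sends? (w ∷ π⁻¹ w ∷ []) (x ∷ y ∷ [])) (Sym n) * ((n ∸ 1) * (n P′ 1))
            ≤⟨ *-monoˡ-≤ _ (count-mono _ _ (Sym n) (λ _ σws≡xy → cong (_∷ []) (∷-injectiveˡ σws≡xy))) ⟩
          count (sends? (w ∷ []) (x ∷ [])) (Sym n) * ((n ∸ 1) * (n P′ 1))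
            ≡⟨ x∙yz≈xz∙y (count (sends? (w ∷ []) (x ∷ [])) (Sym n)) (n ∸ 1) (n P′ 1) ⟩
          count (sends? (w ∷ []) (x ∷ [])) (Sym n) * (n P′ 1) * (n ∸ 1)
            ≡⟨ cong (_* (n ∸ 1)) (count-Sends (w ∷ []) (x ∷ []) ([] ∷ []) ([] ∷ []) refl) ⟩
          length (Sym n) * (n ∸ 1)
            ≡⟨ *-identityˡ _ ⟨
          1 * (length (Sym n) * (n ∸ 1))
            ≤⟨ m≤m+n _ (length (Sym n)) ⟩
          1 * (length (Sym n) * (n ∸ 1)) + length (Sym n) ∎
          where open ≤-Reasoning
        ... | no moved with x ≟ y
        ...   | yes refl = begin
          count ((λ σ → conj⁻¹ σ x ≟ x) ∩? (λ σ → inverse σ x ≟ w)) (Sym n) * (n P′ 2)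
            ≡⟨ cong (_* (n P′ 2)) (count-none _ (Sym n) λ σ∈ in-fibre →
                 let σws≡xx = to (pair-fibre⇔ w σ∈) in-fibre in
                 moved (∈-Sym⁻ σ∈ (trans (∷-injectiveˡ (∷-injectiveʳ σws≡xx)) (sym (∷-injectiveˡ σws≡xx))))) ⟩
          0
            ≤⟨ z≤n ⟩
          length (Sym n) ∎
          where open ≤-Reasoning
        ...   | no x≢y = begin
          count ((λ σ → conj⁻¹ σ x ≟ y) ∩? (λ σ → inverse σ x ≟ w)) (Sym n) * (n P′ 2)
            ≡⟨ cong (_* (n P′ 2)) (pair-fibre≡Sends w) ⟩
          count (sends? (w ∷ π⁻¹ w ∷ []) (x ∷ y ∷ [])) (Sym n) * (n P′ 2)
            ≡⟨ count-Sends _ _ ((moved ∘ sym ∷ []) ∷ [] ∷ []) ((x≢y ∷ []) ∷ [] ∷ []) refl ⟩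
          length (Sym n) ∎
          where open ≤-Reasoning

        -- Split by w = σ⁻¹ x: if π fixes w only σ w ≡ x is prescribed, otherwise two distinct values are.
        pair-collisions : count (λ σ → conj⁻¹ σ x ≟ y) (Sym n) * (n P′ 2)
                          ≤ fix π * (length (Sym n) * (n ∸ 1)) + n * length (Sym n)
        pair-collisions = begin
          count (λ σ → conj⁻¹ σ x ≟ y) (Sym n) * (n P′ 2)
            ≡⟨ cong (_* (n P′ 2))
                    (count-fibres _≟_ _ (λ σ → inverse σ x) (Sym n) (Unique.allFin⁺ n) (λ _ _ → ∈-allFin _)) ⟩
          (∑[ w ∈ allFin n ] count ((λ σ → conj⁻¹ σ x ≟ y) ∩? (λ σ → inverse σ x ≟ w)) (Sym n)) * (n P′ 2)
            ≡⟨ ∑-*ʳ (allFin n) _ (n P′ 2) ⟨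
          ∑[ w ∈ allFin n ] (count ((λ σ → conj⁻¹ σ x ≟ y) ∩? (λ σ → inverse σ x ≟ w)) (Sym n) * (n P′ 2))
            ≤⟨ ∑-mono (allFin n) (λ {w} _ → pair-fibre-bound w) ⟩
          ∑[ w ∈ allFin n ] (𝟙 (π⁻¹ w ≟ w) * S′ + length (Sym n))
            ≡⟨ ∑-+ (allFin n) _ _ ⟩
          (∑[ w ∈ allFin n ] 𝟙 (π⁻¹ w ≟ w) * S′) + (∑[ w ∈ allFin n ] length (Sym n))
            ≡⟨ cong₂ _+_
                 (trans (∑-*ʳ (allFin n) _ S′) (cong (_* S′) (trans (sym (count≡∑𝟙 _ (allFin n))) count-fixed-inverse≡fix)))
                 (trans (∑-const (allFin n) _) (cong (_* length (Sym n)) (length-tabulate {n = n} id))) ⟩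
          fix π * S′ + n * length (Sym n) ∎
          where
          open ≤-Reasoning
          S′ : ℕ
          S′ = length (Sym n) * (n ∸ 1)

  module _ {n k : ℕ} (π : Vec (Fin n) n) (τ : Vec (Fin n) k) where

    open DecMembership (_≟_ {n}) using (_∈?_)
    open DisjointDec (_≟_ {n}) using (disjoint?)

    private
      π⁻¹ : Fin n → Fin n
      π⁻¹ = inverse π

    hit? : Decidable (λ σ → T (hasSubseq τ (conj σ π)))
    hit? σ = T? (hasSubseq τ (conj σ π))

    preimages : Vec (Fin n) n → List (Fin n)
    preimages σ = List.map (inverse σ) (toList τ)

    preimages≟ : (bs : List (Fin n)) → Decidable (λ σ → preimages σ ≡ bs)
    preimages≟ bs σ = ≡-dec _≟_ (preimages σ) bs

    -- Equivalently, preimages σ meets its image under π⁻¹.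
    Collision : Pred (Vec (Fin n) n) 0ℓ
    Collision σ = Any (λ x → conj⁻¹ π σ x ∈ toList τ) (toList τ)

    collision? : Decidable Collision
    collision? σ = any? (λ x → conj⁻¹ π σ x ∈? toList τ) (toList τ)

    Admissible : Pred (List (Fin n)) 0ℓ
    Admissible bs = Unique bs × Disjoint bs (List.map π⁻¹ bs)

    admissible? : Decidable Admissible
    admissible? bs = UniqueDec.unique? _≟_ bs ×-dec disjoint? bs (List.map π⁻¹ bs)

    admissible : List (List (Fin n))
    admissible = filter admissible? (List.map toList (allVecs n k))

    admissible-unique : Unique admissible
    admissible-unique = Unique.filter⁺ admissible? (Unique.map⁺ toList-injective′ (allVecs-unique k))
      where
      toList-injective′ : Injective _≡_ _≡_ (toList {n = k})
      toList-injective′ {xs} {ys} eq = trans (sym (cast-is-id refl xs)) (toList-injective refl xs ys eq)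

    ∈-admissible⁻ : ∀ {bs} → bs ∈ admissible → Admissible bs × length bs ≡ k
    ∈-admissible⁻ bs∈ with ∈-filter⁻ admissible? {xs = List.map toList (allVecs n k)} bs∈
    ... | bs∈′ , adm with v , _ , refl ← ∈-map⁻ toList bs∈′ = adm , length-toList v

    overlap⇒Collision : ∀ {σ} → σ ∈ Sym n → ∀ {x y} → x ∈ toList τ → y ∈ toList τ →
                        π⁻¹ (inverse σ x) ≡ inverse σ y → Collision σ
    overlap⇒Collision {σ} σ∈ {x} {y} x∈ y∈ eq =
      lose x∈ (subst (_∈ toList τ) (trans (sym (lookup∘inverse σ (∈-Sym⁻ σ∈) y)) (cong (lookup σ) (sym eq))) y∈)

    no-collision-fibre : ∀ {σ bs} → σ ∈ Sym n → Admissible bs →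
                         (¬ Collision σ × preimages σ ≡ bs) ⇔ Sends bs (toList τ) σ
    no-collision-fibre {σ} {bs} σ∈ (_ , bs#cs) = mk⇔
      (λ (_ , preimages≡bs) → trans (cong (List.map (lookup σ)) (sym preimages≡bs)) σ∘preimages)
      (λ σbs≡τ → no-collision σbs≡τ , preimages≡ σbs≡τ)
      where
      σ-inj : Injective _≡_ _≡_ (lookup σ)
      σ-inj = ∈-Sym⁻ σ∈
      σ∘preimages : List.map (lookup σ) (preimages σ) ≡ toList τ
      σ∘preimages = trans (sym (map-∘ (toList τ))) (trans (map-cong (lookup∘inverse σ σ-inj) (toList τ)) (map-id (toList τ)))
      preimages≡ : Sends bs (toList τ) σ → preimages σ ≡ bs
      preimages≡ σbs≡τ = begin
        List.map (inverse σ) (toList τ)                ≡⟨ cong (List.map (inverse σ)) σbs≡τ ⟨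
        List.map (inverse σ) (List.map (lookup σ) bs)  ≡⟨ map-∘ bs ⟨
        List.map (inverse σ ∘ lookup σ) bs             ≡⟨ map-cong (inverse∘lookup σ σ-inj) bs ⟩
        List.map id bs                                 ≡⟨ map-id bs ⟩
        bs                                             ∎
        where open ≡-Reasoning
      no-collision : Sends bs (toList τ) σ → ¬ Collision σ
      no-collision σbs≡τ collision with x , x∈ , y∈ ← find collision = bs#cs (v∈bs , v∈cs)
        where
        v : Fin n
        v = π⁻¹ (inverse σ x)
        v∈cs : v ∈ List.map π⁻¹ bs
        v∈cs = subst (λ ps → v ∈ List.map π⁻¹ ps) (preimages≡ σbs≡τ) (∈-map⁺ π⁻¹ (∈-map⁺ (inverse σ) x∈))
        v∈bs : v ∈ bs
        v∈bs = subst₂ _∈_ (inverse∘lookup σ σ-inj v) (preimages≡ σbs≡τ) (∈-map⁺ (inverse σ) y∈)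

    preimages∈admissible : Unique (toList τ) → ∀ {σ} → σ ∈ Sym n → ¬ Collision σ → preimages σ ∈ admissible
    preimages∈admissible τ! {σ} σ∈ no-collision = ∈-filter⁺ admissible?
      (subst (_∈ List.map toList (allVecs n k)) (toList-map (inverse σ) τ) (∈-map⁺ toList (∈-allVecs (Vec.map (inverse σ) τ))))
      (Unique.map⁺ (inverse-injective σ (∈-Sym⁻ σ∈)) τ! , disjoint)
      where
      disjoint : Disjoint (preimages σ) (List.map π⁻¹ (preimages σ))
      disjoint (v∈bs , v∈cs) with ∈-map⁻ (inverse σ) v∈bs
      ... | y , y∈ , refl with ∈-map⁻ π⁻¹ v∈cs
      ...   | w , w∈ , σ⁻¹y≡π⁻¹w with ∈-map⁻ (inverse σ) w∈
      ...     | x , x∈ , refl = no-collision (overlap⇒Collision σ∈ x∈ y∈ (sym σ⁻¹y≡π⁻¹w))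

    module _ (π∈ : π ∈ Sym n) where

      private
        π-inj : Injective _≡_ _≡_ (lookup π)
        π-inj = ∈-Sym⁻ π∈

      hit⇔Increasing : {σ : Vec (Fin n) n} → σ ∈ Sym n →
                       T (hasSubseq τ (conj σ π)) ⇔ Increasing (List.map (lookup σ) (List.map π⁻¹ (preimages σ)))
      hit⇔Increasing {σ} σ∈ = subst (λ ds → T (hasSubseq τ (conj σ π)) ⇔ Increasing ds) split
        (hasSubseq⇔Increasing τ (conj σ π) conj⁻¹∘conj conj∘conj⁻¹)
        where
        σ-inj : Injective _≡_ _≡_ (lookup σ)
        σ-inj = ∈-Sym⁻ σ∈
        conj⁻¹∘conj : ∀ i → conj⁻¹ π σ (lookup (conj σ π) i) ≡ i
        conj⁻¹∘conj i = begin
          lookup σ (π⁻¹ (inverse σ (lookup (conj σ π) i)))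
            ≡⟨ cong (lookup σ ∘ π⁻¹ ∘ inverse σ) (lookup∘tabulate _ i) ⟩
          lookup σ (π⁻¹ (inverse σ (lookup σ (lookup π (inverse σ i)))))
            ≡⟨ cong (lookup σ ∘ π⁻¹) (inverse∘lookup σ σ-inj _) ⟩
          lookup σ (π⁻¹ (lookup π (inverse σ i)))
            ≡⟨ cong (lookup σ) (inverse∘lookup π π-inj _) ⟩
          lookup σ (inverse σ i)
            ≡⟨ lookup∘inverse σ σ-inj i ⟩
          i ∎
          where open ≡-Reasoning
        conj∘conj⁻¹ : ∀ x → lookup (conj σ π) (conj⁻¹ π σ x) ≡ x
        conj∘conj⁻¹ x = begin
          lookup (conj σ π) (lookup σ (π⁻¹ (inverse σ x)))  ≡⟨ lookup-conj σ σ-inj π _ ⟩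
          lookup σ (lookup π (π⁻¹ (inverse σ x)))            ≡⟨ cong (lookup σ) (lookup∘inverse π π-inj _) ⟩
          lookup σ (inverse σ x)                             ≡⟨ lookup∘inverse σ σ-inj x ⟩
          x                                                  ∎
          where open ≡-Reasoning
        split : List.map (conj⁻¹ π σ) (toList τ) ≡ List.map (lookup σ) (List.map π⁻¹ (preimages σ))
        split = trans (map-∘ (toList τ)) (cong (List.map (lookup σ)) (map-∘ (toList τ)))

      hit-fibre⇔ : ∀ {σ bs} → σ ∈ Sym n → Admissible bs →
                   ((T (hasSubseq τ (conj σ π)) × ¬ Collision σ) × preimages σ ≡ bs)
                   ⇔ (Sends bs (toList τ) σ × Increasing (List.map (lookup σ) (List.map π⁻¹ bs)))
      hit-fibre⇔ {σ} {bs} σ∈ adm = mk⇔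
        (λ ((hit , no-collision) , preimages≡bs) →
           to (no-collision-fibre σ∈ adm) (no-collision , preimages≡bs) ,
           subst (λ ps → Increasing (List.map (lookup σ) (List.map π⁻¹ ps))) preimages≡bs (to (hit⇔Increasing σ∈) hit))
        (λ (sends , incr) → let no-collision , preimages≡bs = from (no-collision-fibre σ∈ adm) sends in
           (from (hit⇔Increasing σ∈)
                 (subst (λ ps → Increasing (List.map (lookup σ) (List.map π⁻¹ ps))) (sym preimages≡bs) incr) ,
            no-collision) , preimages≡bs)

      collisions-bound : count collision? (Sym n) * (n P′ 2)
                         ≤ k * (k * (fix π * (length (Sym n) * (n ∸ 1)) + n * length (Sym n)))
      collisions-bound = begin
        count collision? (Sym n) * (n P′ 2)
          ≤⟨ *-monoˡ-≤ (n P′ 2) (count-any≤∑ (λ x σ → conj⁻¹ π σ x ∈? toList τ) (toList τ) (Sym n)) ⟩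
        (∑[ x ∈ toList τ ] count (λ σ → conj⁻¹ π σ x ∈? toList τ) (Sym n)) * (n P′ 2)
          ≡⟨ ∑-*ʳ (toList τ) _ (n P′ 2) ⟨
        ∑[ x ∈ toList τ ] (count (λ σ → conj⁻¹ π σ x ∈? toList τ) (Sym n) * (n P′ 2))
          ≤⟨ ∑-mono (toList τ) (λ {x} _ → from-x x) ⟩
        ∑[ x ∈ toList τ ] (k * K)
          ≡⟨ trans (∑-const (toList τ) (k * K)) (cong (_* (k * K)) (length-toList τ)) ⟩
        k * (k * K) ∎
        where
        open ≤-Reasoning
        K : ℕ
        K = fix π * (length (Sym n) * (n ∸ 1)) + n * length (Sym n)
        from-x : (x : Fin n) → count (λ σ → conj⁻¹ π σ x ∈? toList τ) (Sym n) * (n P′ 2) ≤ k * K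
        from-x x = begin
          count (λ σ → conj⁻¹ π σ x ∈? toList τ) (Sym n) * (n P′ 2)
            ≤⟨ *-monoˡ-≤ (n P′ 2) (count-any≤∑ (λ y σ → conj⁻¹ π σ x ≟ y) (toList τ) (Sym n)) ⟩
          (∑[ y ∈ toList τ ] count (λ σ → conj⁻¹ π σ x ≟ y) (Sym n)) * (n P′ 2)
            ≡⟨ ∑-*ʳ (toList τ) _ (n P′ 2) ⟨
          ∑[ y ∈ toList τ ] (count (λ σ → conj⁻¹ π σ x ≟ y) (Sym n) * (n P′ 2))
            ≤⟨ ∑-mono (toList τ) (λ {y} _ → pair-collisions π π∈ x y) ⟩
          ∑[ y ∈ toList τ ] K
            ≡⟨ trans (∑-const (toList τ) K) (cong (_* K) (length-toList τ)) ⟩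
          k * K ∎

    module _ (π∈ : π ∈ Sym n) (τ! : Unique (toList τ)) where

      hit-fibre : ∀ {bs} → bs ∈ admissible →
                  count ((hit? ∩? ∁? collision?) ∩? preimages≟ bs) (Sym n) * k !
                  ≡ count (∁? collision? ∩? preimages≟ bs) (Sym n)
      hit-fibre {bs} bs∈ = begin
        count ((hit? ∩? ∁? collision?) ∩? preimages≟ bs) (Sym n) * k !
          ≡⟨ cong₂ _*_ (count-cong _ _ (Sym n) (λ σ∈ → from (hit-fibre⇔ π∈ σ∈ adm))
                                               (λ σ∈ → to (hit-fibre⇔ π∈ σ∈ adm)))
                       (cong _! (trans (length-map π⁻¹ bs) |bs|≡k)) ⟨
        count (λ σ → sends? bs (toList τ) σ ×-dec increasing? (List.map (lookup σ) (List.map π⁻¹ bs))) (Sym n)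
          * length (List.map π⁻¹ bs) !
          ≡⟨ count-Sends×Increasing bs! (Unique.map⁺ (inverse-injective π (∈-Sym⁻ π∈)) bs!) bs#cs τ!
                                    (trans |bs|≡k (sym (length-toList τ))) ⟩
        count (sends? bs (toList τ)) (Sym n)
          ≡⟨ count-cong _ _ (Sym n) (λ σ∈ → to (no-collision-fibre σ∈ adm))
                                    (λ σ∈ → from (no-collision-fibre σ∈ adm)) ⟨
        count (∁? collision? ∩? preimages≟ bs) (Sym n) ∎
        where
        open ≡-Reasoning
        adm : Admissible bs
        adm = proj₁ (∈-admissible⁻ bs∈)
        bs! : Unique bs
        bs! = proj₁ adm
        bs#cs : Disjoint bs (List.map π⁻¹ bs)
        bs#cs = proj₂ adm
        |bs|≡k = proj₂ (∈-admissible⁻ bs∈)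

      good-hits : count (hit? ∩? ∁? collision?) (Sym n) * k ! ≡ count (∁? collision?) (Sym n)
      good-hits = begin
        count (hit? ∩? ∁? collision?) (Sym n) * k !
          ≡⟨ cong (_* k !) (count-fibres _≟ₗ_ (hit? ∩? ∁? collision?) preimages (Sym n) admissible-unique
                              (λ σ∈ (_ , no-collision) → preimages∈admissible τ! σ∈ no-collision)) ⟩
        (∑[ bs ∈ admissible ] count ((hit? ∩? ∁? collision?) ∩? preimages≟ bs) (Sym n)) * k !
          ≡⟨ ∑-*ʳ admissible _ (k !) ⟨
        ∑[ bs ∈ admissible ] (count ((hit? ∩? ∁? collision?) ∩? preimages≟ bs) (Sym n) * k !)
          ≡⟨ ∑-cong admissible hit-fibre ⟩
        ∑[ bs ∈ admissible ] count (∁? collision? ∩? preimages≟ bs) (Sym n)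
          ≡⟨ count-fibres _≟ₗ_ (∁? collision?) preimages (Sym n) admissible-unique (preimages∈admissible τ!) ⟨
        count (∁? collision?) (Sym n) ∎
        where
        open ≡-Reasoning
        _≟ₗ_ : DecidableEquality (List (Fin n))
        _≟ₗ_ = ≡-dec _≟_

      hits-upper : count hit? (Sym n) * k ! ≤ length (Sym n) + k ! * count collision? (Sym n)
      hits-upper = begin
        count hit? (Sym n) * k !
          ≡⟨ cong (_* k !) (count-split hit? collision? (Sym n)) ⟩
        (count (hit? ∩? collision?) (Sym n) + count (hit? ∩? ∁? collision?) (Sym n)) * k !
          ≡⟨ *-distribʳ-+ (k !) (count (hit? ∩? collision?) (Sym n)) _ ⟩
        count (hit? ∩? collision?) (Sym n) * k ! + count (hit? ∩? ∁? collision?) (Sym n) * k !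
          ≡⟨ cong (count (hit? ∩? collision?) (Sym n) * k ! +_) good-hits ⟩
        count (hit? ∩? collision?) (Sym n) * k ! + count (∁? collision?) (Sym n)
          ≤⟨ +-mono-≤ (*-monoˡ-≤ (k !) (count-mono _ _ (Sym n) (λ _ → proj₂))) (length-filter (∁? collision?) (Sym n)) ⟩
        count collision? (Sym n) * k ! + length (Sym n)
          ≡⟨ trans (+-comm (count collision? (Sym n) * k !) (length (Sym n))) (cong (length (Sym n) +_) (*-comm _ (k !))) ⟩
        length (Sym n) + k ! * count collision? (Sym n) ∎
        where open ≤-Reasoning

      hits-lower : length (Sym n) ≤ count hit? (Sym n) * k ! + count collision? (Sym n)
      hits-lower = begin
        length (Sym n)
          ≡⟨ count+count-∁ collision? (Sym n) ⟨
        count collision? (Sym n) + count (∁? collision?) (Sym n)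
          ≡⟨ cong (count collision? (Sym n) +_) good-hits ⟨
        count collision? (Sym n) + count (hit? ∩? ∁? collision?) (Sym n) * k !
          ≤⟨ +-monoʳ-≤ (count collision? (Sym n)) (*-monoˡ-≤ (k !) (count-mono _ _ (Sym n) (λ _ → proj₁))) ⟩
        count collision? (Sym n) + count hit? (Sym n) * k !
          ≡⟨ +-comm (count collision? (Sym n)) _ ⟩
        count hit? (Sym n) * k ! + count collision? (Sym n) ∎
        where open ≤-Reasoning

module ConjugationClosedCollections where

  open import Data.Bool.Base using (true)
  open import Data.Bool.Properties using (T-≡)
  open import Data.Fin.Base using (Fin)
  open import Data.List.Base using (length)
  open import Data.List.Membership.Propositional using (_∈_)
  open import Data.List.Membership.Propositional.Properties using (∈-filter⁺; ∈-filter⁻)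
  open import Data.List.Relation.Unary.Unique.Propositional using (Unique)
  import Data.List.Relation.Unary.Unique.Propositional.Properties as Unique
  open import Data.Nat.Base using (ℕ; _+_; _*_; _∸_; _!; _≤_)
  open import Data.Nat.Combinatorics.Base using (_P′_)
  open import Data.Nat.Properties
  open import Data.Product using (proj₁; proj₂)
  open import Data.Vec.Base using (Vec; lookup; toList)
  open import Function.Base using (_∘_)
  open import Function.Bundles using (module Equivalence)
  open import Function.Definitions using (Injective)
  open import Relation.Binary.PropositionalEquality
  open import Relation.Nullary.Decidable using (T?)
  open Equivalence using (to; from)
  open Counting
  open Permutations
  open RandomConjugate

  ConjugationClosed : Collection → Set
  ConjugationClosed P = ∀ (n : ℕ) (π σ ρ : Vec (Fin n) n) → π ∈ Sym n → σ ∈ Sym n → ρ ∈ Sym n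
    → (∀ (i : Fin n) → lookup ρ (lookup σ i) ≡ lookup σ (lookup π i))
    → P n π ≡ true → P n ρ ≡ true

  module _ (P : Collection) {n : ℕ} where

    ∈-Slice⁻ : ∀ {π} → π ∈ Slice P n → π ∈ Sym n
    ∈-Slice⁻ π∈ = proj₁ (∈-filter⁻ (T? ∘ P n) {xs = Sym n} π∈)

    Slice-unique : Unique (Slice P n)
    Slice-unique = Unique.filter⁺ (T? ∘ P n) Sym-unique

    module _ {k : ℕ} (τ : Vec (Fin n) k) where

      totalCollisions : ℕ
      totalCollisions = ∑[ π ∈ Slice P n ] count (collision? π τ) (Sym n)

      total-collisions : totalCollisions * (n P′ 2)
                         ≤ k * (k * (totalFix P n * (length (Sym n) * (n ∸ 1)) + card P n * (n * length (Sym n))))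
      total-collisions = begin
        totalCollisions * (n P′ 2)
          ≡⟨ ∑-*ʳ (Slice P n) _ (n P′ 2) ⟨
        ∑[ π ∈ Slice P n ] (count (collision? π τ) (Sym n) * (n P′ 2))
          ≤⟨ ∑-mono (Slice P n) (λ π∈ → collisions-bound _ τ (∈-Slice⁻ π∈)) ⟩
        ∑[ π ∈ Slice P n ] (k * (k * (fix π * S′ + n * length (Sym n))))
          ≡⟨ trans (∑-*ˡ (Slice P n) k _) (cong (k *_) (∑-*ˡ (Slice P n) k _)) ⟩
        k * (k * (∑[ π ∈ Slice P n ] fix π * S′ + n * length (Sym n)))
          ≡⟨ cong (λ t → k * (k * t))
                  (trans (∑-+ (Slice P n) _ _) (cong₂ _+_ (∑-*ʳ (Slice P n) fix S′) (∑-const (Slice P n) _))) ⟩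
        k * (k * (totalFix P n * S′ + card P n * (n * length (Sym n)))) ∎
        where
        open ≤-Reasoning
        S′ : ℕ
        S′ = length (Sym n) * (n ∸ 1)

  module _ {P : Collection} (closed : ConjugationClosed P) {n : ℕ} where

    conj-∈-Slice : ∀ {σ π} → σ ∈ Sym n → π ∈ Slice P n → conj σ π ∈ Slice P n
    conj-∈-Slice {σ} {π} σ∈ π∈ = ∈-filter⁺ (T? ∘ P n) ρ∈ (from T-≡ (closed n π σ (conj σ π) π∈S σ∈ ρ∈
      (lookup-conj σ (∈-Sym⁻ σ∈) π) (to T-≡ (proj₂ (∈-filter⁻ (T? ∘ P n) {xs = Sym n} π∈)))))
      where
      π∈S : π ∈ Sym n
      π∈S = ∈-Slice⁻ P π∈
      ρ∈ : conj σ π ∈ Sym n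
      ρ∈ = conj-∈-Sym σ (∈-Sym⁻ σ∈) π∈S

    module _ {k : ℕ} (τ : Vec (Fin n) k) where

      -- Each conjugation σ relabels Slice P n bijectively, so every σ contributes h P n τ hits.
      ∑-hits : ∑[ π ∈ Slice P n ] count (hit? π τ) (Sym n) ≡ length (Sym n) * h P n τ
      ∑-hits = begin
        ∑[ π ∈ Slice P n ] count (hit? π τ) (Sym n)
          ≡⟨ ∑-cong (Slice P n) (λ _ → count≡∑𝟙 _ (Sym n)) ⟩
        ∑[ π ∈ Slice P n ] ∑[ σ ∈ Sym n ] 𝟙 (hit? π τ σ)
          ≡⟨ ∑-comm (Slice P n) (Sym n) _ ⟩
        ∑[ σ ∈ Sym n ] ∑[ π ∈ Slice P n ] 𝟙 (hit? π τ σ)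
          ≡⟨ ∑-cong (Sym n) (λ _ → count≡∑𝟙 _ (Slice P n)) ⟨
        ∑[ σ ∈ Sym n ] count (λ π → T? (hasSubseq τ (conj σ π))) (Slice P n)
          ≡⟨ ∑-cong (Sym n) relabel ⟩
        ∑[ σ ∈ Sym n ] h P n τ
          ≡⟨ ∑-const (Sym n) _ ⟩
        length (Sym n) * h P n τ ∎
        where
        open ≡-Reasoning
        relabel : ∀ {σ} → σ ∈ Sym n → count (λ π → T? (hasSubseq τ (conj σ π))) (Slice P n) ≡ h P n τ
        relabel {σ} σ∈ = count-bijection (T? ∘ hasSubseq τ) (conj σ) (conj (σ ⁻¹)) (Slice-unique P) (Slice-unique P)
          (conj-injective σ σ-inj) (conj-∈-Slice σ∈) (conj-∈-Slice (∈-Sym⁺ {σ = σ ⁻¹} (⁻¹-injective σ σ-inj)))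
          (λ _ → conj-conj⁻¹ σ σ-inj _)
          where
          σ-inj : Injective _≡_ _≡_ (lookup σ)
          σ-inj = ∈-Sym⁻ σ∈

      module _ (τ! : Unique (toList τ)) where

        total-hits-upper : length (Sym n) * h P n τ * k ! ≤ card P n * length (Sym n) + k ! * totalCollisions P τ
        total-hits-upper = begin
          length (Sym n) * h P n τ * k !
            ≡⟨ cong (_* k !) ∑-hits ⟨
          (∑[ π ∈ Slice P n ] count (hit? π τ) (Sym n)) * k !
            ≡⟨ ∑-*ʳ (Slice P n) _ (k !) ⟨
          ∑[ π ∈ Slice P n ] (count (hit? π τ) (Sym n) * k !)
            ≤⟨ ∑-mono (Slice P n) (λ π∈ → hits-upper _ τ (∈-Slice⁻ P π∈) τ!) ⟩
          ∑[ π ∈ Slice P n ] (length (Sym n) + k ! * count (collision? π τ) (Sym n))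
            ≡⟨ ∑-+ (Slice P n) _ _ ⟩
          (∑[ π ∈ Slice P n ] length (Sym n)) + (∑[ π ∈ Slice P n ] k ! * count (collision? π τ) (Sym n))
            ≡⟨ cong₂ _+_ (∑-const (Slice P n) _) (∑-*ˡ (Slice P n) (k !) _) ⟩
          card P n * length (Sym n) + k ! * totalCollisions P τ ∎
          where open ≤-Reasoning

        total-hits-lower : card P n * length (Sym n) ≤ length (Sym n) * h P n τ * k ! + totalCollisions P τ
        total-hits-lower = begin
          card P n * length (Sym n)
            ≡⟨ ∑-const (Slice P n) _ ⟨
          ∑[ π ∈ Slice P n ] length (Sym n)
            ≤⟨ ∑-mono (Slice P n) (λ π∈ → hits-lower _ τ (∈-Slice⁻ P π∈) τ!) ⟩
          ∑[ π ∈ Slice P n ] (count (hit? π τ) (Sym n) * k ! + count (collision? π τ) (Sym n))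
            ≡⟨ ∑-+ (Slice P n) _ _ ⟩
          (∑[ π ∈ Slice P n ] count (hit? π τ) (Sym n) * k !) + totalCollisions P τ
            ≡⟨ cong (_+ totalCollisions P τ) (trans (∑-*ʳ (Slice P n) _ (k !)) (cong (_* k !) ∑-hits)) ⟩
          length (Sym n) * h P n τ * k ! + totalCollisions P τ ∎
          where open ≤-Reasoning

module Estimates where

  open import Data.Fin.Base using (Fin)
  open import Data.Empty using (⊥-elim)
  open import Data.Integer.Base as ℤ using (+_; +[1+_]; _⊖_; +<+)
  import Data.Integer.Properties as ℤP
  open import Data.List.Base using (length)
  open import Data.List.Properties using (length-filter)
  open import Data.List.Relation.Unary.Unique.Propositional using (Unique)
  open import Data.Nat.Base using (ℕ; suc; _+_; _*_; _∸_; _!; _≤_; _<_; z≤n; s≤s; NonZero; >-nonZero)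
  open import Data.Nat.Combinatorics.Base using (_P′_)
  open import Data.Nat.Properties
  open import Data.Nat.Solver using (module +-*-Solver)
  open import Data.Product using (_×_; _,_; uncurry)
  open import Data.Rational.Base as ℚ using (ℚ; mkℚ; 0ℚ; ∣_∣; _-_; -_; toℚᵘ; ↧ₙ_; positive)
    renaming (_≤_ to _≤ℚ_; _<_ to _<ℚ_; _*_ to _*ℚ_)
  open import Data.Rational.Properties
    using (toℚᵘ-fromℚᵘ; toℚᵘ-cancel-<; toℚᵘ-cancel-≤; toℚᵘ-mono-≤; toℚᵘ-homo-∣-∣; toℚᵘ-homo-+; toℚᵘ-homo‿-; toℚᵘ-homo-*)
  open import Data.Rational.Unnormalised.Base as ℚᵘ using (mkℚᵘ; *<*; *≤*) renaming (_≃_ to _≃ᵘ_)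
  import Data.Rational.Unnormalised.Properties as ℚᵘ
  open import Data.Vec.Base using (Vec; toList)
  open import Function.Base using (_∘_)
  open import Relation.Binary.PropositionalEquality
  open import Relation.Nullary using (yes; no)
  open import Relation.Nullary.Decidable using (T?)
  open +-*-Solver using (solve; _:*_; _:+_; _:=_; con)
  open ConjugationClosedCollections

  -- B/(cs) ≤ k² (T/(cn) + 1/(n−1)), and both terms are below 1/(2q).
  collisions-negligible : (B s c T n k q : ℕ) → 0 < c → 0 < s →
                          B * (n P′ 2) ≤ k * (k * (T * (s * (n ∸ 1)) + c * (n * s))) →
                          T * suc (2 * (k * k) * q) ≤ n * c → 2 * (k * k) * q < n ∸ 1 →
                          B * q < c * s
  collisions-negligible B s c T n k q 0<c 0<s collisions few-fixed-points n-large =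
    *-cancelʳ-< (n P′ 2) (B * q) (c * s) (begin-strict
      B * q * (n P′ 2)
        ≡⟨ solve 3 (λ B q M → B :* q :* M := B :* M :* q) refl B q (n P′ 2) ⟩
      B * (n P′ 2) * q
        ≤⟨ *-monoˡ-≤ q collisions ⟩
      k * (k * (T * (s * n₁) + c * (n * s))) * q
        ≡⟨ solve 7 (λ k T s n₁ c n q → k :* (k :* (T :* (s :* n₁) :+ c :* (n :* s))) :* q
                                       := s :* (k :* k :* q :* (T :* n₁ :+ c :* n))) refl k T s n₁ c n q ⟩
      s * (k * k * q * (T * n₁ + c * n))
        <⟨ *-monoʳ-< s {{>-nonZero 0<s}} per-permutation ⟩
      s * (c * (n P′ 2))
        ≡⟨ solve 3 (λ s c M → s :* (c :* M) := c :* s :* M) refl s c (n P′ 2) ⟩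
      c * s * (n P′ 2) ∎)
    where
    open ≤-Reasoning
    n₁ m : ℕ
    n₁ = n ∸ 1
    m = 2 * (k * k) * q
    0<n : 0 < n
    0<n = ≤-trans (s≤s z≤n) (≤-trans n-large (m∸n≤m n 1))
    mT≤nc : m * T ≤ n * c
    mT≤nc = ≤-trans (≤-reflexive (*-comm m T)) (≤-trans (*-monoʳ-≤ T (n≤1+n m)) few-fixed-points)
    per-permutation : k * k * q * (T * n₁ + c * n) < c * (n P′ 2)
    per-permutation = *-cancelˡ-< 2 _ _ (begin-strict
      2 * (k * k * q * (T * n₁ + c * n))
        ≡⟨ solve 6 (λ k q T n₁ c n → con 2 :* (k :* k :* q :* (T :* n₁ :+ c :* n))
                                     := con 2 :* (k :* k) :* q :* T :* n₁ :+ con 2 :* (k :* k) :* q :* (c :* n))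
                   refl k q T n₁ c n ⟩
      m * T * n₁ + m * (c * n)
        <⟨ +-mono-≤-< (*-monoˡ-≤ n₁ mT≤nc) (*-monoˡ-< (c * n) {{>-nonZero (*-mono-< 0<c 0<n)}} n-large) ⟩
      n * c * n₁ + n₁ * (c * n)
        ≡⟨ solve 3 (λ n c n₁ → n :* c :* n₁ :+ n₁ :* (c :* n) := con 2 :* (c :* (n₁ :* (n :* con 1)))) refl n c n₁ ⟩
      2 * (c * (n P′ 2)) ∎)

  -- The conclusion is |H/c − 1/F| < 1/q with denominators cleared.
  cross-multiplied-closeness : (s H F c B q : ℕ) → 0 < s → 0 < F →
                               s * H * F ≤ c * s + F * B → c * s ≤ s * H * F + B → B * q < c * s →
                               H * F * q < c * q + c * F × c * q < H * F * q + c * F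
  cross-multiplied-closeness s H F c B q 0<s 0<F upper lower negligible =
    *-cancelˡ-< s _ _ (begin-strict
      s * (H * F * q)
        ≡⟨ solve 4 (λ s H F q → s :* (H :* F :* q) := s :* H :* F :* q) refl s H F q ⟩
      s * H * F * q
        ≤⟨ *-monoˡ-≤ q upper ⟩
      (c * s + F * B) * q
        ≡⟨ solve 5 (λ c s F B q → (c :* s :+ F :* B) :* q := s :* (c :* q) :+ F :* (B :* q)) refl c s F B q ⟩
      s * (c * q) + F * (B * q)
        <⟨ +-monoʳ-< (s * (c * q)) (*-monoʳ-< F {{>-nonZero 0<F}} negligible) ⟩
      s * (c * q) + F * (c * s)
        ≡⟨ solve 4 (λ s c q F → s :* (c :* q) :+ F :* (c :* s) := s :* (c :* q :+ c :* F)) refl s c q F ⟩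
      s * (c * q + c * F) ∎) ,
    *-cancelˡ-< s _ _ (begin-strict
      s * (c * q)
        ≡⟨ solve 3 (λ s c q → s :* (c :* q) := c :* s :* q) refl s c q ⟩
      c * s * q
        ≤⟨ *-monoˡ-≤ q lower ⟩
      (s * H * F + B) * q
        ≡⟨ solve 5 (λ s H F B q → (s :* H :* F :+ B) :* q := s :* (H :* F :* q) :+ B :* q) refl s H F B q ⟩
      s * (H * F * q) + B * q
        <⟨ +-monoʳ-< (s * (H * F * q)) negligible ⟩
      s * (H * F * q) + c * s
        ≤⟨ +-monoʳ-≤ (s * (H * F * q)) (m≤m*n (c * s) F {{>-nonZero 0<F}}) ⟩
      s * (H * F * q) + c * s * F
        ≡⟨ solve 5 (λ s H F q c → s :* (H :* F :* q) :+ c :* s :* F := s :* (H :* F :* q :+ c :* F)) refl s H F q c ⟩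
      s * (H * F * q + c * F) ∎)
    where open ≤-Reasoning

  ratio-suc≃ : (a b : ℕ) → toℚᵘ (ratio a (suc b)) ≃ᵘ mkℚᵘ (+ a) b
  ratio-suc≃ a b = toℚᵘ-fromℚᵘ (mkℚᵘ (+ a) b)

  ∣ratio-ratio∣<1/q : (H c F q : ℕ) .{{_ : NonZero c}} .{{_ : NonZero F}} .{{_ : NonZero q}} →
                      H * F * q < c * q + c * F → c * q < H * F * q + c * F →
                      ∣ ratio H c - ratio 1 F ∣ <ℚ ratio 1 q
  ∣ratio-ratio∣<1/q H (suc c′) (suc f′) (suc q′) above below =
    toℚᵘ-cancel-< (ℚᵘ.<-respʳ-≃ (ℚᵘ.≃-sym (ratio-suc≃ 1 q′)) (ℚᵘ.<-respˡ-≃ (ℚᵘ.≃-sym unnormalised) (*<* cross)))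
    where
    c f q : ℕ
    c = suc c′
    f = suc f′
    q = suc q′
    x y : ℚ
    x = ratio H c
    y = ratio 1 f
    unnormalised : toℚᵘ ∣ x - y ∣ ≃ᵘ ℚᵘ.∣ mkℚᵘ (+ H) c′ ℚᵘ.- mkℚᵘ (+ 1) f′ ∣
    unnormalised = ℚᵘ.≃-trans (toℚᵘ-homo-∣-∣ (x - y))
      (ℚᵘ.∣-∣-cong (ℚᵘ.≃-trans (toℚᵘ-homo-+ x (- y))
        (ℚᵘ.+-cong (ratio-suc≃ H c′) (ℚᵘ.≃-trans (toℚᵘ-homo‿- y) (ℚᵘ.-‿cong (ratio-suc≃ 1 f′))))))
    numerator : + H ℤ.* + f ℤ.+ ℤ.- (+ 1) ℤ.* + c ≡ (H * f) ⊖ c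
    numerator = trans (cong₂ ℤ._+_ (sym (ℤP.pos-* H f)) (cong ℤ.-_ (ℤP.*-identityˡ (+ c)))) (ℤP.m-n≡m⊖n (H * f) c)
    distance : ℤ.∣ (H * f) ⊖ c ∣ * q < c * f
    distance with c ≤? H * f
    ... | yes c≤Hf =
      subst (λ d → d * q < c * f) (sym (cong ℤ.∣_∣ (ℤP.⊖-≥ c≤Hf)))
        (subst (_< c * f) (sym (*-distribʳ-∸ q (H * f) c)) (m<n+o⇒m∸n<o (H * f * q) (c * q) above))
    ... | no  c≰Hf =
      subst (λ d → d * q < c * f) (sym (trans (cong ℤ.∣_∣ (ℤP.⊖-< (≰⇒> c≰Hf))) (ℤP.∣-i∣≡∣i∣ (+ (c ∸ H * f)))))
        (subst (_< c * f) (sym (*-distribʳ-∸ q c (H * f))) (m<n+o⇒m∸n<o (c * q) (H * f * q) below))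
    cross : + ℤ.∣ + H ℤ.* + f ℤ.+ ℤ.- (+ 1) ℤ.* + c ∣ ℤ.* + q ℤ.< + 1 ℤ.* + (c * f)
    cross = subst₂ ℤ._<_ (trans (ℤP.pos-* ℤ.∣ (H * f) ⊖ c ∣ q) (cong (λ z → + ℤ.∣ z ∣ ℤ.* + q) (sym numerator)))
                         (sym (ℤP.*-identityˡ (+ (c * f)))) (+<+ distance)

  1/↧ₙ≤ : (ε : ℚ) → 0ℚ <ℚ ε → ratio 1 (↧ₙ ε) ≤ℚ ε
  1/↧ₙ≤ (mkℚ +[1+ p ] d _) _ = toℚᵘ-cancel-≤ (ℚᵘ.≤-respˡ-≃ (ℚᵘ.≃-sym (ratio-suc≃ 1 d))
    (*≤* (ℤP.*-monoʳ-≤-nonNeg (+ suc d) {+ 1} {+[1+ p ]} (ℤ.+≤+ (s≤s z≤n)))))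
  1/↧ₙ≤ (mkℚ (+ 0) _ _) ε>0 = ⊥-elim (ℤ.Positive.pos (positive ε>0))
  1/↧ₙ≤ (mkℚ ℤ.-[1+ _ ] _ _) ε>0 = ⊥-elim (ℤ.Positive.pos (positive ε>0))

  1/suc>0 : (m : ℕ) → 0ℚ <ℚ ratio 1 (suc m)
  1/suc>0 m = toℚᵘ-cancel-< (ℚᵘ.<-respʳ-≃ (ℚᵘ.≃-sym (ratio-suc≃ 1 m)) (*<* (+<+ (s≤s z≤n))))

  ratio≤ratio*n⇒ : (T c m n : ℕ) .{{_ : NonZero c}} →
                   ratio T c ≤ℚ ratio 1 (suc m) *ℚ ((+ n) ℚ./ 1) → T * suc m ≤ n * c
  ratio≤ratio*n⇒ T (suc c′) m n ratio≤ with ℚᵘ.≤-respʳ-≃ product (ℚᵘ.≤-respˡ-≃ (ratio-suc≃ T c′) (toℚᵘ-mono-≤ ratio≤))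
    where
    product : toℚᵘ (ratio 1 (suc m) *ℚ ((+ n) ℚ./ 1)) ≃ᵘ mkℚᵘ (+ 1) m ℚᵘ.* mkℚᵘ (+ n) 0
    product = ℚᵘ.≃-trans (toℚᵘ-homo-* (ratio 1 (suc m)) ((+ n) ℚ./ 1)) (ℚᵘ.*-cong (ratio-suc≃ 1 m) (ratio-suc≃ n 0))
  ... | *≤* cross = subst₂ _≤_ (cong (T *_) (*-identityʳ (suc m))) (cong (_* suc c′) (*-identityˡ n))
    (ℤP.drop‿+≤+ (subst₂ ℤ._≤_ (sym (ℤP.pos-* T (suc m * 1)))
      (trans (cong (ℤ._* + suc c′) (sym (ℤP.pos-* 1 n))) (sym (ℤP.pos-* (1 * n) (suc c′)))) cross))

  deviation<1/q : {P : Collection} → ConjugationClosed P → {n k : ℕ} (τ : Vec (Fin n) k) → Unique (toList τ) →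
                  (q : ℕ) .{{_ : NonZero q}} → 0 < card P n →
                  totalFix P n * suc (2 * (k * k) * q) ≤ n * card P n → 2 * (k * k) * q < n ∸ 1 →
                  ∣ ptilde P n τ - invFact k ∣ <ℚ ratio 1 q
  deviation<1/q {P} closed {n} {k} τ τ! q card>0 few-fixed-points n-large =
    uncurry (∣ratio-ratio∣<1/q (h P n τ) (card P n) (k !) q {{>-nonZero card>0}} {{k !≢0}})
            (cross-multiplied-closeness (length (Sym n)) (h P n τ) (k !) (card P n) (totalCollisions P τ) q
               Sym>0 (1≤n! k) (total-hits-upper closed τ τ!) (total-hits-lower closed τ τ!) negligible)
    where
    Sym>0 : 0 < length (Sym n)
    Sym>0 = ≤-trans card>0 (length-filter (T? ∘ P n) (Sym n))
    negligible : totalCollisions P τ * q < card P n * length (Sym n)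
    negligible = collisions-negligible (totalCollisions P τ) (length (Sym n)) (card P n) (totalFix P n) n k q
                   card>0 Sym>0 (total-collisions P τ) few-fixed-points n-large

open import Data.Bool using (true)
open import Data.Nat using (ℕ; _≤_; _<_)
open import Data.Fin using (Fin)
open import Data.Vec using (Vec; lookup; toList)
open import Data.List.Relation.Unary.Unique.Propositional using (Unique)
open import Data.List.Membership.Propositional using (_∈_)
open import Data.Integer using (+_)
open import Data.Rational using (ℚ; 0ℚ; _*_; _-_; ∣_∣) renaming (_≤_ to _≤ℚ_; _<_ to _<ℚ_)
open import Data.Product using (Σ; _×_)
open import Relation.Binary.PropositionalEquality using (_≡_)
import Data.Nat as ℕ
import Data.Nat.Properties as ℕ
open import Data.Product using (_,_; proj₁; proj₂)
open import Data.Rational.Properties using (<-≤-trans)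
open Estimates using (deviation<1/q; 1/↧ₙ≤; 1/suc>0; ratio≤ratio*n⇒)

theorem2 : (P : Collection)
    -- P_n nonempty for infinitely many n
    → (∀ (m : ℕ) → Σ ℕ (λ n → m ≤ n × 0 < card P n))
    -- each P_n is a union of conjugacy classes of S_n:
    -- if π ∈ P_n and ρ = σ π σ⁻¹ (i.e. ρ ∘ σ = σ ∘ π) with σ ∈ S_n, then ρ ∈ P_n
    → (∀ (n : ℕ) (π σ ρ : Vec (Fin n) n) → π ∈ Sym n → σ ∈ Sym n → ρ ∈ Sym n
         → (∀ (i : Fin n) → lookup ρ (lookup σ i) ≡ lookup σ (lookup π i))
         → P n π ≡ true → P n ρ ≡ true)
    -- average number of fixed points is o(n) (over n with P_n nonempty)
    → (∀ (ε : ℚ) → 0ℚ <ℚ ε → Σ ℕ (λ N → ∀ (n : ℕ) → N ≤ n → 0 < card P n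
         → avgFix P n ≤ℚ ε * ((+ n) Data.Rational./ 1)))
    -- conclusion: P is quasirandom
    → ∀ (k : ℕ) → 1 ≤ k → ∀ (ε : ℚ) → 0ℚ <ℚ ε → Σ ℕ (λ N → ∀ (n : ℕ) → N ≤ n → 0 < card P n
         → ∀ (τ : Vec (Fin n) k) → Unique (toList τ)
         → ∣ ptilde P n τ - invFact k ∣ <ℚ ε)
theorem2 P _ closed few-fixed-points k _ ε ε>0 = N ℕ.+ (2 ℕ.+ m) , λ n N+2+m≤n card>0 τ τ! →
  <-≤-trans (deviation<1/q closed τ τ! q card>0
               (ratio≤ratio*n⇒ (totalFix P n) (card P n) m n {{ℕ.>-nonZero card>0}}
                  (fixed-points-bound n (ℕ.m+n≤o⇒m≤o N N+2+m≤n) card>0))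
               (ℕ.∸-monoˡ-≤ 1 (ℕ.m+n≤o⇒n≤o N N+2+m≤n)))
            (1/↧ₙ≤ ε ε>0)
  where
  q m N : ℕ
  q = Data.Rational.↧ₙ ε
  m = 2 ℕ.* (k ℕ.* k) ℕ.* q
  N = proj₁ (few-fixed-points (ratio 1 (ℕ.suc m)) (1/suc>0 m))
  fixed-points-bound : ∀ n → N ≤ n → 0 < card P n → avgFix P n ≤ℚ ratio 1 (ℕ.suc m) * ((+ n) Data.Rational./ 1)
  fixed-points-bound = proj₂ (few-fixed-points (ratio 1 (ℕ.suc m)) (1/suc>0 m))
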